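{- Let $\mathcal P$ be an optimal schedule, let $I=[x,y]$ be an interval, and let $B\subseteq\mathcal J$ be the set of jobs $a$ such that the total length of $a$ executed in $I$ is strictly between $0$ and $y-x$. If the jobs in $B$ are pairwise independent, and $C_{\mathcal P}(a)\ge y$ and $r(a)\le x$ for each $a\in B$, then $|B|\le 2$.
   Context: Scheduling setting. $\mathcal{J}$ is a finite set of jobs, each with processing time $1$ and a nonnegative integer release date $r(a)$. A precedence relation $\prec$ on $\mathcal{J}$ ($a\prec b$ means $b$ may not start before $a$ has completed) forms an in-tree: each job has at most one immediate successor. Jobs $a,b$ are independent if neither $a\prec b$ nor $b\prec a$. Jobs are scheduled preemptively on two identical processors: each job is processed in pieces of total length $1$, never on both processors at the same time, never before its release date, and no piece of $b$ is processed before every $a\prec b$ has completed. $C_{\mathcal P}(a)$ is the completion time of $a$. A schedule is optimal if it minimizes $\sum_a C_{\mathcal P}(a)$ among all such preemptive schedules.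
   Formalization: The schedule $\mathcal P$ and the endpoints of $I=[x,y]$ take rational times rather than real ones, and optimality is taken only among schedules with rational time points. -}

module Defs where

open import Data.Nat as ℕ using (ℕ)
open import Data.Fin using (Fin)
open import Data.Fin.Properties using () renaming (_≟_ to _≟F_)
open import Data.Maybe using (Maybe; just)
open import Data.List using (List; length; lookup; foldr; filter; allFin)
open import Data.Integer using (+_)
open import Data.Rational using (ℚ; _≤_; _<_; _+_; _-_; _⊔_; _⊓_; 0ℚ; 1ℚ; _/_)
open import Data.Rational.Properties using (_<?_)
open import Data.Product using (_×_; Σ)
open import Data.Sum using (_⊎_)
open import Data.Bool using (if_then_else_)
open import Relation.Nullary using (¬_; Dec; does)
open import Relation.Nullary.Decidable using (_×-dec_)
open import Relation.Binary.PropositionalEquality using (_≡_; _≢_)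

-- Instance: n unit jobs (Fin n), integer release dates, in-tree precedence
-- given by the (at most one) immediate successor of each job.

record Instance : Set where
  field
    n    : ℕ
    rel  : Fin n → ℕ
    succ : Fin n → Maybe (Fin n)

module _ (J : Instance) where
  open Instance J

  data _≺_ : Fin n → Fin n → Set where
    step  : ∀ {a b} → succ a ≡ just b → a ≺ b
    trans : ∀ {a b c} → a ≺ b → b ≺ c → a ≺ c

  Independent : Fin n → Fin n → Set
  Independent a b = ¬ (a ≺ b) × ¬ (b ≺ a)

  r : Fin n → ℚ
  r a = (+ rel a) / 1

  -- Preemptive schedules on two processors with rational time points:
  -- a schedule is a finite list of pieces (job, processor, [start,end)).

  record Piece : Set where
    constructor piece
    field
      job   : Fin n
      proc  : Fin 2
      start : ℚ
      end   : ℚ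

  open Piece public

  Schedule : Set
  Schedule = List Piece

  len : Schedule → Fin n → ℚ
  len S a = foldr (λ p acc → if does (job p ≟F a) then (end p - start p) + acc else acc) 0ℚ S

  C : Schedule → Fin n → ℚ
  C S a = foldr (λ p acc → if does (job p ≟F a) then end p ⊔ acc else acc) 0ℚ S

  lenIn : Schedule → ℚ → ℚ → Fin n → ℚ
  lenIn S x y a =
    foldr (λ p acc → if does (job p ≟F a)
                     then (0ℚ ⊔ ((end p ⊓ y) - (start p ⊔ x))) + acc
                     else acc) 0ℚ S

  Disjoint : Piece → Piece → Set
  Disjoint p q = end p ≤ start q ⊎ end q ≤ start p

  record Feasible (S : Schedule) : Set where
    field
      nonempty   : ∀ i → start (lookup S i) < end (lookup S i)
      released   : ∀ i → r (job (lookup S i)) ≤ start (lookup S i)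
      unitLength : ∀ a → len S a ≡ 1ℚ
      procOK     : ∀ i j → i ≢ j → proc (lookup S i) ≡ proc (lookup S j)
                   → Disjoint (lookup S i) (lookup S j)
      jobOK      : ∀ i j → i ≢ j → job (lookup S i) ≡ job (lookup S j)
                   → Disjoint (lookup S i) (lookup S j)
      precOK     : ∀ a i → a ≺ job (lookup S i) → C S a ≤ start (lookup S i)

  TotalCompletion : Schedule → ℚ
  TotalCompletion S = foldr (λ a acc → C S a + acc) 0ℚ (allFin n)

  Optimal : Schedule → Set
  Optimal S = Feasible S × (∀ S' → Feasible S' → TotalCompletion S ≤ TotalCompletion S')

  InB : Schedule → ℚ → ℚ → Fin n → Set
  InB S x y a = 0ℚ < lenIn S x y a × lenIn S x y a < y - x

  inB? : ∀ S x y a → Dec (InB S x y a)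
  inB? S x y a = (0ℚ <? lenIn S x y a) ×-dec (lenIn S x y a <? y - x)

  cardB : Schedule → ℚ → ℚ → ℕ
  cardB S x y = length (filter (inB? S x y) (allFin n))

{-# OPTIONS --safe #-}
-- Let a be a job of B with the least completion time C(a) ≥ y. As a runs for less than y - x in I,
-- it is absent from a subwindow [v₁, v₂] of I. Two exchanges would lower C(a) without delaying any
-- job, contradicting optimality: moving a last slice of a into a window of I where a is absent and
-- a processor is idle, or swapping it with a slice of a job q, C(q) ≥ C(a), that runs in such a
-- window and is not running at time C(a). Let b ≠ a be in B and not running at C(a). If a does not
-- fill the part of I where b runs, swap a with b. Otherwise both processors are busy in [v₁, v₂],
-- and every job running there is running at C(a): else it can be swapped with a, or it completes
-- before a, so is not in B and fills I, and with a and b gives three jobs filling one window of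
-- two processors. Only one job besides a runs at C(a), and alone it cannot keep two processors
-- busy. Hence every job of B other than a runs at time C(a), and there is at most one of them.
module Submission where

open import Defs hiding (trans; step)
open import Data.Bool using (Bool; true; false; if_then_else_; _∨_)
open import Data.Empty using (⊥; ⊥-elim)
open import Data.Fin using (Fin; zero; suc)
open import Data.Fin.Properties using () renaming (_≟_ to _≟ᶠ_)
open import Data.List using (List; []; _∷_; _++_; foldr; concatMap; upTo; allFin; filter; length)
open import Data.List.Membership.Propositional using (_∈_; find; lose)
open import Data.List.Relation.Unary.All as All using (All; []; _∷_)
open import Data.List.Relation.Unary.Any as Any using (Any; here; there)
open import Data.List.Relation.Unary.AllPairs as AllPairs using (AllPairs; []; _∷_)
open import Data.Maybe using (Maybe; just; nothing)
open import Data.Rational using (ℚ)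
open import Data.Product using (_×_; _,_; ∃; proj₁; proj₂)
open import Data.Sum as Sum using (_⊎_; inj₁; inj₂)
open import Function using (_∘_)
open import Relation.Binary.PropositionalEquality
  using (_≡_; _≢_; refl; sym; trans; cong; cong₂; subst; subst₂; module ≡-Reasoning)
open import Relation.Binary using (tri<; tri≈; tri>)
open import Relation.Nullary using (¬_; Dec; yes; no; does)
open import Relation.Nullary.Decidable using (_×-dec_; dec-true)

module Interval where

  open import Data.Rational
  open import Data.Rational.Properties
  open import Data.Rational.Solver using (module +-*-Solver)
  open +-*-Solver using (solve; _:=_; _:+_; _:-_)

  p≤q⇒p-q≤0 : ∀ {p q} → p ≤ q → p - q ≤ 0ℚ
  p≤q⇒p-q≤0 {p} {q} p≤q = subst (p - q ≤_) (+-inverseʳ q) (+-monoˡ-≤ (- q) p≤q)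

  p≤q⇒0≤q-p : ∀ {p q} → p ≤ q → 0ℚ ≤ q - p
  p≤q⇒0≤q-p {p} {q} p≤q = subst (_≤ q - p) (+-inverseʳ p) (+-monoˡ-≤ (- p) p≤q)

  p<q⇒0<q-p : ∀ {p q} → p < q → 0ℚ < q - p
  p<q⇒0<q-p {p} {q} p<q = subst (_< q - p) (+-inverseʳ p) (+-monoˡ-< (- p) p<q)

  q-p+p≡q : ∀ p q → q - p + p ≡ q
  q-p+p≡q p q = solve 2 (λ q p → q :- p :+ p := q) refl q p

  0≤q-p⇒p≤q : ∀ {p q} → 0ℚ ≤ q - p → p ≤ q
  0≤q-p⇒p≤q {p} {q} 0≤q-p = subst₂ _≤_ (+-identityˡ p) (q-p+p≡q p q) (+-monoˡ-≤ p 0≤q-p)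

  0<q-p⇒p<q : ∀ {p q} → 0ℚ < q - p → p < q
  0<q-p⇒p<q {p} {q} 0<q-p = subst₂ _<_ (+-identityˡ p) (q-p+p≡q p q) (+-monoˡ-< p 0<q-p)

  p≤p+q : ∀ {p q} → 0ℚ ≤ q → p ≤ p + q
  p≤p+q {p} {q} 0≤q = subst (_≤ p + q) (+-identityʳ p) (+-monoʳ-≤ p 0≤q)

  p≤q+p : ∀ {p q} → 0ℚ ≤ q → p ≤ q + p
  p≤q+p {p} {q} 0≤q = subst (_≤ q + p) (+-identityˡ p) (+-monoˡ-≤ p 0≤q)

  p<p+q : ∀ p {q} → 0ℚ < q → p < p + q
  p<p+q p {q} 0<q = subst (_< p + q) (+-identityʳ p) (+-monoʳ-< p 0<q)

  δ≤q-p⇒p+δ≤q : ∀ {p q δ} → δ ≤ q - p → p + δ ≤ q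
  δ≤q-p⇒p+δ≤q {p} {q} {δ} δ≤q-p = subst (p + δ ≤_) (solve 2 (λ p q → p :+ (q :- p) := q) refl p q) (+-monoʳ-≤ p δ≤q-p)

  δ≤q-p⇒p≤q-δ : ∀ {p q δ} → δ ≤ q - p → p ≤ q - δ
  δ≤q-p⇒p≤q-δ {p} {q} {δ} δ≤q-p =
    subst (_≤ q - δ) (solve 2 (λ p q → q :- (q :- p) := p) refl p q) (+-monoʳ-≤ q (neg-antimono-≤ δ≤q-p))

  ⊓-pos : ∀ {p q} → 0ℚ < p → 0ℚ < q → 0ℚ < p ⊓ q
  ⊓-pos {p} {q} 0<p 0<q with ⊓-sel p q
  ... | inj₁ p⊓q≡p = subst (0ℚ <_) (sym p⊓q≡p) 0<p
  ... | inj₂ p⊓q≡q = subst (0ℚ <_) (sym p⊓q≡q) 0<q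

  clamp : ℚ → ℚ → ℚ → ℚ
  clamp s e t = s ⊔ (e ⊓ t)

  overlapLen : ℚ → ℚ → ℚ → ℚ → ℚ
  overlapLen s e u v = 0ℚ ⊔ ((e ⊓ v) - (s ⊔ u))

  clamp-mono : ∀ s e {t t′} → t ≤ t′ → clamp s e t ≤ clamp s e t′
  clamp-mono s e t≤t′ = ⊔-monoʳ-≤ s (⊓-monoʳ-≤ e t≤t′)

  lo≤clamp : ∀ s e t → s ≤ clamp s e t
  lo≤clamp s e t = p≤p⊔q s (e ⊓ t)

  clamp≤hi : ∀ s e t → s ≤ e → clamp s e t ≤ e
  clamp≤hi s e t s≤e = ⊔-lub s≤e (p⊓q≤p e t)

  clamp-below : ∀ s e t → t ≤ s → clamp s e t ≡ s
  clamp-below s e t t≤s = p≥q⇒p⊔q≡p (≤-trans (p⊓q≤q e t) t≤s)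

  clamp-above : ∀ s e t → s ≤ e → e ≤ t → clamp s e t ≡ e
  clamp-above s e t s≤e e≤t = trans (cong (s ⊔_) (p≤q⇒p⊓q≡p e≤t)) (p≤q⇒p⊔q≡q s≤e)

  clamp≤arg : ∀ s e t → s < clamp s e t → clamp s e t ≤ t
  clamp≤arg s e t s<c with ⊔-sel s (e ⊓ t)
  ... | inj₁ c≡s = ⊥-elim (<-irrefl (sym c≡s) s<c)
  ... | inj₂ c≡e⊓t = ≤-trans (≤-reflexive c≡e⊓t) (p⊓q≤q e t)

  arg≤clamp : ∀ s e t → clamp s e t < e → t ≤ clamp s e t
  arg≤clamp s e t c<e with ⊓-sel e t
  ... | inj₂ e⊓t≡t = ≤-trans (≤-reflexive (sym e⊓t≡t)) (p≤q⊔p s (e ⊓ t))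
  ... | inj₁ e⊓t≡e = ⊥-elim (<-irrefl refl
          (<-≤-trans c<e (≤-trans (≤-reflexive (sym e⊓t≡e)) (p≤q⊔p s (e ⊓ t)))))

  overlapLen-nonneg : ∀ s e u v → 0ℚ ≤ overlapLen s e u v
  overlapLen-nonneg s e u v = p≤p⊔q 0ℚ ((e ⊓ v) - (s ⊔ u))

  overlapLen-comm : ∀ s e u v → overlapLen s e u v ≡ overlapLen u v s e
  overlapLen-comm s e u v = cong (0ℚ ⊔_) (cong₂ _-_ (⊓-comm e v) (⊔-comm s u))

  overlapLen-empty : ∀ s e u v → e ⊓ v ≤ s ⊔ u → overlapLen s e u v ≡ 0ℚ
  overlapLen-empty s e u v le = p≥q⇒p⊔q≡p (p≤q⇒p-q≤0 le)

  overlapLen-disjoint : ∀ s e u v → e ≤ u ⊎ v ≤ s → overlapLen s e u v ≡ 0ℚ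
  overlapLen-disjoint s e u v (inj₁ e≤u) =
    overlapLen-empty s e u v (≤-trans (p⊓q≤p e v) (≤-trans e≤u (p≤q⊔p s u)))
  overlapLen-disjoint s e u v (inj₂ v≤s) =
    overlapLen-empty s e u v (≤-trans (p⊓q≤q e v) (≤-trans v≤s (p≤p⊔q s u)))

  overlapLen≡clamp-diff : ∀ s e u v → s ≤ e → u ≤ v → overlapLen s e u v ≡ clamp s e v - clamp s e u
  overlapLen≡clamp-diff s e u v s≤e u≤v with ≤-total v s | ≤-total e u
  ... | inj₁ v≤s | _ = begin
    overlapLen s e u v         ≡⟨ overlapLen-disjoint s e u v (inj₂ v≤s) ⟩
    0ℚ                         ≡⟨ sym (+-inverseʳ s) ⟩
    s - s                      ≡⟨ sym (cong₂ _-_ (clamp-below s e v v≤s) (clamp-below s e u (≤-trans u≤v v≤s))) ⟩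
    clamp s e v - clamp s e u  ∎
    where open ≡-Reasoning
  ... | inj₂ _ | inj₁ e≤u = begin
    overlapLen s e u v         ≡⟨ overlapLen-disjoint s e u v (inj₁ e≤u) ⟩
    0ℚ                         ≡⟨ sym (+-inverseʳ e) ⟩
    e - e                      ≡⟨ sym (cong₂ _-_ (clamp-above s e v s≤e (≤-trans e≤u u≤v)) (clamp-above s e u s≤e e≤u)) ⟩
    clamp s e v - clamp s e u  ∎
    where open ≡-Reasoning
  ... | inj₂ s≤v | inj₂ u≤e = begin
    overlapLen s e u v         ≡⟨ p≤q⇒p⊔q≡q (p≤q⇒0≤q-p (⊔-lub (⊓-glb s≤e s≤v) (⊓-glb u≤e u≤v))) ⟩
    (e ⊓ v) - (s ⊔ u)          ≡⟨ cong₂ _-_ (sym (p≤q⇒p⊔q≡q (⊓-glb s≤e s≤v))) (cong (s ⊔_) (sym (p≥q⇒p⊓q≡q u≤e))) ⟩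
    clamp s e v - clamp s e u  ∎
    where open ≡-Reasoning

  overlapLen-split : ∀ s e u m v → s ≤ e → u ≤ m → m ≤ v →
                     overlapLen s e u v ≡ overlapLen s e u m + overlapLen s e m v
  overlapLen-split s e u m v s≤e u≤m m≤v = begin
    overlapLen s e u v
      ≡⟨ overlapLen≡clamp-diff s e u v s≤e (≤-trans u≤m m≤v) ⟩
    clamp s e v - clamp s e u
      ≡⟨ solve 3 (λ a b c → a :- c := (b :- c) :+ (a :- b)) refl (clamp s e v) (clamp s e m) (clamp s e u) ⟩
    (clamp s e m - clamp s e u) + (clamp s e v - clamp s e m)
      ≡⟨ sym (cong₂ _+_ (overlapLen≡clamp-diff s e u m s≤e u≤m) (overlapLen≡clamp-diff s e m v s≤e m≤v)) ⟩
    overlapLen s e u m + overlapLen s e m v ∎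
    where open ≡-Reasoning

  overlapLen-full : ∀ s e u v → s ≤ u → u ≤ v → v ≤ e → overlapLen s e u v ≡ v - u
  overlapLen-full s e u v s≤u u≤v v≤e = begin
    0ℚ ⊔ ((e ⊓ v) - (s ⊔ u))  ≡⟨ cong (0ℚ ⊔_) (cong₂ _-_ (p≥q⇒p⊓q≡q v≤e) (p≤q⇒p⊔q≡q s≤u)) ⟩
    0ℚ ⊔ (v - u)              ≡⟨ p≤q⇒p⊔q≡q (p≤q⇒0≤q-p u≤v) ⟩
    v - u                     ∎
    where open ≡-Reasoning

  overlapLen-pos⇒ : ∀ s e u v → 0ℚ < overlapLen s e u v → s ⊔ u < e ⊓ v
  overlapLen-pos⇒ s e u v pos with 0ℚ <? ((e ⊓ v) - (s ⊔ u))
  ... | yes 0<d = 0<q-p⇒p<q 0<d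
  ... | no 0≮d  = ⊥-elim (<-irrefl (sym (p≥q⇒p⊔q≡p (≮⇒≥ 0≮d))) pos)

  overlapLen-pos⇐ : ∀ {s e u v} → s < e → s < v → u < e → u < v → 0ℚ < overlapLen s e u v
  overlapLen-pos⇐ {s} {e} {u} {v} s<e s<v u<e u<v = <-≤-trans (p<q⇒0<q-p max<min) (p≤q⊔p 0ℚ _)
    where
    max<min : s ⊔ u < e ⊓ v
    max<min with ⊔-sel s u | ⊓-sel e v
    ... | inj₁ ≡s | inj₁ ≡e = subst₂ _<_ (sym ≡s) (sym ≡e) s<e
    ... | inj₁ ≡s | inj₂ ≡v = subst₂ _<_ (sym ≡s) (sym ≡v) s<v
    ... | inj₂ ≡u | inj₁ ≡e = subst₂ _<_ (sym ≡u) (sym ≡e) u<e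
    ... | inj₂ ≡u | inj₂ ≡v = subst₂ _<_ (sym ≡u) (sym ≡v) u<v

  overlapLen-mono : ∀ s e u u′ v′ v → s ≤ e → u ≤ u′ → u′ ≤ v′ → v′ ≤ v → overlapLen s e u′ v′ ≤ overlapLen s e u v
  overlapLen-mono s e u u′ v′ v s≤e u≤u′ u′≤v′ v′≤v = begin
    overlapLen s e u′ v′                       ≤⟨ p≤p+q (overlapLen-nonneg s e v′ v) ⟩
    overlapLen s e u′ v′ + overlapLen s e v′ v ≡⟨ sym (overlapLen-split s e u′ v′ v s≤e u′≤v′ v′≤v) ⟩
    overlapLen s e u′ v                        ≤⟨ p≤q+p (overlapLen-nonneg s e u u′) ⟩
    overlapLen s e u u′ + overlapLen s e u′ v  ≡⟨ sym (overlapLen-split s e u u′ v s≤e u≤u′ (≤-trans u′≤v′ v′≤v)) ⟩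
    overlapLen s e u v                         ∎
    where open ≤-Reasoning

module FilteredSum {A : Set} where

  open import Data.Rational
  open import Data.Rational.Properties
  open import Data.Rational.Solver using (module +-*-Solver)
  open +-*-Solver using (solve; _:=_; _:+_)
  open Interval using (p≤p+q)

  sumIf : (A → Bool) → (A → ℚ) → List A → ℚ
  sumIf φ f []       = 0ℚ
  sumIf φ f (p ∷ ps) = if φ p then f p + sumIf φ f ps else sumIf φ f ps

  sumAll : (A → ℚ) → List A → ℚ
  sumAll = sumIf (λ _ → true)

  maxIf : (A → Bool) → (A → ℚ) → List A → ℚ
  maxIf φ g []       = 0ℚ
  maxIf φ g (p ∷ ps) = if φ p then g p ⊔ maxIf φ g ps else maxIf φ g ps

  NonNeg : (A → ℚ) → List A → Set
  NonNeg f = All (λ p → 0ℚ ≤ f p)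

  private
    interchange : ∀ a b c d → (a + b) + (c + d) ≡ (a + c) + (b + d)
    interchange = solve 4 (λ a b c d → (a :+ b) :+ (c :+ d) := (a :+ c) :+ (b :+ d)) refl

    left-comm : ∀ a b c → a + (b + c) ≡ b + (a + c)
    left-comm = solve 3 (λ a b c → a :+ (b :+ c) := b :+ (a :+ c)) refl

  sumIf-++ : ∀ φ f xs ys → sumIf φ f (xs ++ ys) ≡ sumIf φ f xs + sumIf φ f ys
  sumIf-++ φ f []       ys = sym (+-identityˡ _)
  sumIf-++ φ f (p ∷ xs) ys with φ p
  ... | true  = trans (cong (f p +_) (sumIf-++ φ f xs ys)) (sym (+-assoc (f p) _ _))
  ... | false = sumIf-++ φ f xs ys

  sumIf-∷-true : ∀ φ f {p} ps → φ p ≡ true → sumIf φ f (p ∷ ps) ≡ f p + sumIf φ f ps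
  sumIf-∷-true φ f ps φp rewrite φp = refl

  sumIf-∷-false : ∀ φ f {p} ps → φ p ≡ false → sumIf φ f (p ∷ ps) ≡ sumIf φ f ps
  sumIf-∷-false φ f ps φp rewrite φp = refl

  sumIf-none : ∀ φ f ps → All (λ p → φ p ≡ false) ps → sumIf φ f ps ≡ 0ℚ
  sumIf-none φ f []       []         = refl
  sumIf-none φ f (p ∷ ps) (φp ∷ φps) = trans (sumIf-∷-false φ f ps φp) (sumIf-none φ f ps φps)

  sumIf-cong : ∀ φ f g ps → All (λ p → f p ≡ g p) ps → sumIf φ f ps ≡ sumIf φ g ps
  sumIf-cong φ f g []       []         = refl
  sumIf-cong φ f g (p ∷ ps) (e ∷ es) with φ p
  ... | true  = cong₂ _+_ e (sumIf-cong φ f g ps es)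
  ... | false = sumIf-cong φ f g ps es

  sumIf-cong-filter : ∀ φ ψ f ps → All (λ p → φ p ≡ ψ p) ps → sumIf φ f ps ≡ sumIf ψ f ps
  sumIf-cong-filter φ ψ f []       []         = refl
  sumIf-cong-filter φ ψ f (p ∷ ps) (e ∷ es) rewrite e =
    cong (λ z → if ψ p then f p + z else z) (sumIf-cong-filter φ ψ f ps es)

  sumIf-+ : ∀ φ f g ps → sumIf φ (λ p → f p + g p) ps ≡ sumIf φ f ps + sumIf φ g ps
  sumIf-+ φ f g []       = sym (+-identityˡ 0ℚ)
  sumIf-+ φ f g (p ∷ ps) with φ p
  ... | true  = trans (cong ((f p + g p) +_) (sumIf-+ φ f g ps)) (interchange (f p) (g p) _ _)
  ... | false = sumIf-+ φ f g ps

  sumIf-neg : ∀ φ f ps → sumIf φ (λ p → - f p) ps ≡ - sumIf φ f ps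
  sumIf-neg φ f []       = refl
  sumIf-neg φ f (p ∷ ps) with φ p
  ... | true  = trans (cong (- f p +_) (sumIf-neg φ f ps)) (sym (neg-distrib-+ (f p) _))
  ... | false = sumIf-neg φ f ps

  sumIf-- : ∀ φ f g ps → sumIf φ (λ p → f p - g p) ps ≡ sumIf φ f ps - sumIf φ g ps
  sumIf-- φ f g ps = trans (sumIf-+ φ f (λ p → - g p) ps) (cong (sumIf φ f ps +_) (sumIf-neg φ g ps))

  sumAll-indicator : ∀ φ f ps → sumAll (λ p → if φ p then f p else 0ℚ) ps ≡ sumIf φ f ps
  sumAll-indicator φ f []       = refl
  sumAll-indicator φ f (p ∷ ps) with φ p
  ... | true  = cong (f p +_) (sumAll-indicator φ f ps)
  ... | false = trans (+-identityˡ _) (sumAll-indicator φ f ps)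

  sumIf-nonneg : ∀ φ f ps → NonNeg f ps → 0ℚ ≤ sumIf φ f ps
  sumIf-nonneg φ f []       []         = ≤-refl
  sumIf-nonneg φ f (p ∷ ps) (h ∷ hs) with φ p
  ... | true  = subst (_≤ f p + sumIf φ f ps) (+-identityˡ 0ℚ) (+-mono-≤ h (sumIf-nonneg φ f ps hs))
  ... | false = sumIf-nonneg φ f ps hs

  sumIf-nonpos : ∀ φ f ps → All (λ p → φ p ≡ true → f p ≤ 0ℚ) ps → sumIf φ f ps ≤ 0ℚ
  sumIf-nonpos φ f []       []         = ≤-refl
  sumIf-nonpos φ f (p ∷ ps) (h ∷ hs) with φ p
  ... | true  = subst (f p + sumIf φ f ps ≤_) (+-identityˡ 0ℚ) (+-mono-≤ (h refl) (sumIf-nonpos φ f ps hs))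
  ... | false = sumIf-nonpos φ f ps hs

  term≤sumIf : ∀ φ f ps {p} → p ∈ ps → φ p ≡ true → NonNeg f ps → f p ≤ sumIf φ f ps
  term≤sumIf φ f (q ∷ ps) (here refl) φq (h ∷ hs) rewrite φq = p≤p+q (sumIf-nonneg φ f ps hs)
  term≤sumIf φ f (q ∷ ps) (there p∈) φp (h ∷ hs) with φ q
  ... | true  = subst (_≤ f q + sumIf φ f ps) (+-identityˡ _) (+-mono-≤ h (term≤sumIf φ f ps p∈ φp hs))
  ... | false = term≤sumIf φ f ps p∈ φp hs

  sumIf-pos : ∀ φ f ps → 0ℚ < sumIf φ f ps → Any (λ p → φ p ≡ true × 0ℚ < f p) ps
  sumIf-pos φ f []       pos = ⊥-elim (<-irrefl refl pos)
  sumIf-pos φ f (p ∷ ps) pos with φ p in φp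
  ... | false = there (sumIf-pos φ f ps pos)
  ... | true with 0ℚ <? f p
  ...   | yes 0<fp = here (φp , 0<fp)
  ...   | no 0≮fp  = there (sumIf-pos φ f ps (<-≤-trans pos drop-p))
    where
    drop-p : f p + sumIf φ f ps ≤ sumIf φ f ps
    drop-p = subst (f p + sumIf φ f ps ≤_) (+-identityˡ _) (+-monoˡ-≤ (sumIf φ f ps) (≮⇒≥ 0≮fp))

  sumIf-filter-≤ : ∀ φ ψ f ps → NonNeg f ps → All (λ p → φ p ≡ true → ψ p ≡ false → f p ≤ 0ℚ) ps →
                   sumIf φ f ps ≤ sumIf ψ f ps
  sumIf-filter-≤ φ ψ f []       []         []         = ≤-refl
  sumIf-filter-≤ φ ψ f (p ∷ ps) (h ∷ hs) (k ∷ ks) with φ p | ψ p | k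
  ... | true  | true  | _  = +-monoʳ-≤ (f p) (sumIf-filter-≤ φ ψ f ps hs ks)
  ... | true  | false | k′ = subst (f p + sumIf φ f ps ≤_) (+-identityˡ _) (+-mono-≤ (k′ refl refl) (sumIf-filter-≤ φ ψ f ps hs ks))
  ... | false | true  | _  = subst (_≤ f p + sumIf ψ f ps) (+-identityˡ _) (+-mono-≤ h (sumIf-filter-≤ φ ψ f ps hs ks))
  ... | false | false | _  = sumIf-filter-≤ φ ψ f ps hs ks

  sumIf-∨ : ∀ φ ψ f ps → All (λ p → φ p ≡ true → ψ p ≡ true → ⊥) ps →
            sumIf φ f ps + sumIf ψ f ps ≡ sumIf (λ p → φ p ∨ ψ p) f ps
  sumIf-∨ φ ψ f []       []         = +-identityˡ 0ℚ
  sumIf-∨ φ ψ f (p ∷ ps) (k ∷ ks) with φ p | ψ p | k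
  ... | true  | true  | k′ = ⊥-elim (k′ refl refl)
  ... | true  | false | _  = trans (+-assoc (f p) _ _) (cong (f p +_) (sumIf-∨ φ ψ f ps ks))
  ... | false | true  | _  = trans (left-comm (sumIf φ f ps) (f p) _) (cong (f p +_) (sumIf-∨ φ ψ f ps ks))
  ... | false | false | _  = sumIf-∨ φ ψ f ps ks

  maxIf-nonneg : ∀ φ g ps → 0ℚ ≤ maxIf φ g ps
  maxIf-nonneg φ g []       = ≤-refl
  maxIf-nonneg φ g (p ∷ ps) with φ p
  ... | true  = ≤-trans (maxIf-nonneg φ g ps) (p≤q⊔p (g p) _)
  ... | false = maxIf-nonneg φ g ps

  maxIf-lub : ∀ φ g ps {b} → 0ℚ ≤ b → All (λ p → φ p ≡ true → g p ≤ b) ps → maxIf φ g ps ≤ b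
  maxIf-lub φ g []       0≤b []         = 0≤b
  maxIf-lub φ g (p ∷ ps) 0≤b (h ∷ hs) with φ p
  ... | true  = ⊔-lub (h refl) (maxIf-lub φ g ps 0≤b hs)
  ... | false = maxIf-lub φ g ps 0≤b hs

  term≤maxIf : ∀ φ g ps {p} → p ∈ ps → φ p ≡ true → g p ≤ maxIf φ g ps
  term≤maxIf φ g (q ∷ ps) (here refl) φq rewrite φq = p≤p⊔q (g q) _
  term≤maxIf φ g (q ∷ ps) (there p∈) φp with φ q
  ... | true  = ≤-trans (term≤maxIf φ g ps p∈ φp) (p≤q⊔p (g q) _)
  ... | false = term≤maxIf φ g ps p∈ φp

  maxIf-attained : ∀ φ g ps → 0ℚ < maxIf φ g ps → Any (λ p → φ p ≡ true × g p ≡ maxIf φ g ps) ps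
  maxIf-attained φ g []       pos = ⊥-elim (<-irrefl refl pos)
  maxIf-attained φ g (p ∷ ps) pos with φ p in φp
  ... | false = there (maxIf-attained φ g ps pos)
  ... | true with ≤-total (maxIf φ g ps) (g p)
  ...   | inj₁ m≤gp = here (φp , sym (p≥q⇒p⊔q≡p m≤gp))
  ...   | inj₂ gp≤m rewrite p≤q⇒p⊔q≡q gp≤m = there (maxIf-attained φ g ps pos)

  maxIf-< : ∀ φ g ps {b} → 0ℚ < b → All (λ p → φ p ≡ true → g p < b) ps → maxIf φ g ps < b
  maxIf-< φ g ps 0<b hs with 0ℚ <? maxIf φ g ps
  ... | no 0≮m = ≤-<-trans (≮⇒≥ 0≮m) 0<b
  ... | yes 0<m with find (maxIf-attained φ g ps 0<m)
  ...   | p , p∈ , φp , gp≡m = subst (_< _) gp≡m (All.lookup hs p∈ φp)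

module Schedules (J : Instance) where

  open import Data.Rational
  open import Data.Rational.Properties
  open import Data.Rational.Solver using (module +-*-Solver)
  open +-*-Solver using (solve; _:=_; _:+_; _:-_)
  open import Data.Fin.Properties using (suc-injective)
  open Instance J
  open Interval
  open FilteredSum

  Pc : Set
  Pc = Piece J

  ofJob : Fin n → Pc → Bool
  ofJob a p = does (job p ≟ᶠ a)

  onProc : Fin 2 → Pc → Bool
  onProc i p = does (proc p ≟ᶠ i)

  ofJob⇒≡ : ∀ {a} p → ofJob a p ≡ true → job p ≡ a
  ofJob⇒≡ {a} p h with job p ≟ᶠ a
  ... | yes e = e

  ≡⇒ofJob : ∀ {a} p → job p ≡ a → ofJob a p ≡ true
  ≡⇒ofJob {a} p e with job p ≟ᶠ a
  ... | yes _ = refl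
  ... | no ne = ⊥-elim (ne e)

  ≢⇒ofJob : ∀ {a} p → job p ≢ a → ofJob a p ≡ false
  ≢⇒ofJob {a} p ne with job p ≟ᶠ a
  ... | yes e = ⊥-elim (ne e)
  ... | no _ = refl

  onProc⇒≡ : ∀ {i} p → onProc i p ≡ true → proc p ≡ i
  onProc⇒≡ {i} p h with proc p ≟ᶠ i
  ... | yes e = e

  ≡⇒onProc : ∀ {i} p → proc p ≡ i → onProc i p ≡ true
  ≡⇒onProc {i} p e with proc p ≟ᶠ i
  ... | yes _ = refl
  ... | no ne = ⊥-elim (ne e)

  duration : Pc → ℚ
  duration p = end p - start p

  timeIn : ℚ → ℚ → Pc → ℚ
  timeIn u v p = overlapLen (start p) (end p) u v

  timeIn-nonneg : ∀ u v S → NonNeg (timeIn u v) S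
  timeIn-nonneg u v S = All.universal (λ p → overlapLen-nonneg (start p) (end p) u v) S

  lenIn≡sumIf : ∀ S u v a → lenIn J S u v a ≡ sumIf (ofJob a) (timeIn u v) S
  lenIn≡sumIf []      u v a = refl
  lenIn≡sumIf (p ∷ S) u v a = cong (λ z → if ofJob a p then timeIn u v p + z else z) (lenIn≡sumIf S u v a)

  len≡sumIf : ∀ S a → len J S a ≡ sumIf (ofJob a) duration S
  len≡sumIf []      a = refl
  len≡sumIf (p ∷ S) a = cong (λ z → if ofJob a p then duration p + z else z) (len≡sumIf S a)

  C≡maxIf : ∀ S a → C J S a ≡ maxIf (ofJob a) end S
  C≡maxIf []      a = refl
  C≡maxIf (p ∷ S) a = cong (λ z → if ofJob a p then end p ⊔ z else z) (C≡maxIf S a)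

  C-nonneg : ∀ S a → 0ℚ ≤ C J S a
  C-nonneg S a = subst (0ℚ ≤_) (sym (C≡maxIf S a)) (maxIf-nonneg (ofJob a) end S)

  end≤C : ∀ {S p} → p ∈ S → ∀ {a} → job p ≡ a → end p ≤ C J S a
  end≤C {S} {p} p∈ {a} jp = subst (end p ≤_) (sym (C≡maxIf S a)) (term≤maxIf (ofJob a) end S p∈ (≡⇒ofJob p jp))

  C≤⇒ : ∀ S {a b} → 0ℚ ≤ b → All (λ p → job p ≡ a → end p ≤ b) S → C J S a ≤ b
  C≤⇒ S {a} 0≤b h = subst (_≤ _) (sym (C≡maxIf S a)) (maxIf-lub (ofJob a) end S 0≤b (All.map (λ {p} k o → k (ofJob⇒≡ p o)) h))

  record LastPiece (S : List Pc) (a : Fin n) : Set where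
    field
      last     : Pc
      last∈    : last ∈ S
      job-last : job last ≡ a
      end-last : end last ≡ C J S a

  last-piece : ∀ S a → 0ℚ < C J S a → LastPiece S a
  last-piece S a pos with find (maxIf-attained (ofJob a) end S (subst (0ℚ <_) (C≡maxIf S a) pos))
  ... | p , p∈ , o , e = record { last = p ; last∈ = p∈ ; job-last = ofJob⇒≡ p o ; end-last = trans e (sym (C≡maxIf S a)) }

  positive-piece : ∀ S w u v → 0ℚ < sumIf (ofJob w) (timeIn u v) S → ∃ λ p → p ∈ S × job p ≡ w × 0ℚ < timeIn u v p
  positive-piece S w u v pos with find (sumIf-pos (ofJob w) (timeIn u v) S pos)
  ... | p , p∈ , o , 0<t = p , p∈ , ofJob⇒≡ p o , 0<t

  r-nonneg : ∀ a → 0ℚ ≤ r J a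
  r-nonneg a = nonNegative⁻¹ _ {{normalize-nonNeg (rel a) 1}}

  false≢true : false ≢ true
  false≢true ()

  Disjoint-sym : ∀ {p q} → Disjoint J p q → Disjoint J q p
  Disjoint-sym (inj₁ h) = inj₂ h
  Disjoint-sym (inj₂ h) = inj₁ h

  Avoids : (Pc → Bool) → ℚ → ℚ → List Pc → Set
  Avoids φ lo hi = All (λ p → φ p ≡ true → end p ≤ lo ⊎ hi ≤ start p)

  avoids-shrink : ∀ {φ lo hi lo′ hi′ S} → lo ≤ lo′ → hi′ ≤ hi → Avoids φ lo hi S → Avoids φ lo′ hi′ S
  avoids-shrink lo≤lo′ hi′≤hi = All.map (λ h φp → Sum.map (λ e≤ → ≤-trans e≤ lo≤lo′) (≤-trans hi′≤hi) (h φp))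

  SameProc⇒Disjoint SameJob⇒Disjoint : Pc → Pc → Set
  SameProc⇒Disjoint p q = proc p ≡ proc q → Disjoint J p q
  SameJob⇒Disjoint  p q = job p ≡ job q → Disjoint J p q

  record FeasibleList (S : List Pc) : Set where
    field
      nonempty : All (λ p → start p < end p) S
      released : All (λ p → r J (job p) ≤ start p) S
      procOK   : AllPairs SameProc⇒Disjoint S
      jobOK    : AllPairs SameJob⇒Disjoint S

  private
    All⇐lookup : ∀ {P : Pc → Set} S → (∀ i → P (Data.List.lookup S i)) → All P S
    All⇐lookup []      h = []
    All⇐lookup (p ∷ S) h = h zero ∷ All⇐lookup S (h ∘ suc)

    All⇒lookup : ∀ {P : Pc → Set} {S} → All P S → ∀ i → P (Data.List.lookup S i)
    All⇒lookup (px ∷ _)   zero    = px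
    All⇒lookup (_  ∷ pxs) (suc i) = All⇒lookup pxs i

    AllPairs⇐lookup : ∀ {R : Pc → Pc → Set} S →
      (∀ i j → i ≢ j → R (Data.List.lookup S i) (Data.List.lookup S j)) → AllPairs R S
    AllPairs⇐lookup []      h = []
    AllPairs⇐lookup (p ∷ S) h =
      All⇐lookup S (λ i → h zero (suc i) (λ ())) ∷ AllPairs⇐lookup S (λ i j i≢j → h (suc i) (suc j) (i≢j ∘ suc-injective))

    AllPairs⇒lookup : ∀ {R : Pc → Pc → Set} → (∀ {p q} → R p q → R q p) → ∀ {S} → AllPairs R S →
      ∀ i j → i ≢ j → R (Data.List.lookup S i) (Data.List.lookup S j)
    AllPairs⇒lookup sym-R (px ∷ pxs) zero    zero    i≢j = ⊥-elim (i≢j refl)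
    AllPairs⇒lookup sym-R (px ∷ pxs) zero    (suc j) i≢j = All⇒lookup px j
    AllPairs⇒lookup sym-R (px ∷ pxs) (suc i) zero    i≢j = sym-R (All⇒lookup px i)
    AllPairs⇒lookup sym-R (px ∷ pxs) (suc i) (suc j) i≢j = AllPairs⇒lookup sym-R pxs i j (i≢j ∘ cong suc)

  feasible⇒list : ∀ {S} → Feasible J S → FeasibleList S
  feasible⇒list {S} F = record
    { nonempty = All⇐lookup S (Feasible.nonempty F)
    ; released = All⇐lookup S (Feasible.released F)
    ; procOK   = AllPairs⇐lookup S (Feasible.procOK F)
    ; jobOK    = AllPairs⇐lookup S (Feasible.jobOK F)
    }

  PrecedenceOK : List Pc → Set
  PrecedenceOK S = All (λ p → ∀ a → _≺_ J a (job p) → C J S a ≤ start p) S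

  list⇒feasible : ∀ {S} → FeasibleList S → (∀ a → len J S a ≡ 1ℚ) → PrecedenceOK S → Feasible J S
  list⇒feasible F unit prec = record
    { nonempty   = All⇒lookup (FeasibleList.nonempty F)
    ; released   = All⇒lookup (FeasibleList.released F)
    ; unitLength = unit
    ; procOK     = AllPairs⇒lookup {SameProc⇒Disjoint} (λ {p} {q} h e → Disjoint-sym {p} {q} (h (sym e))) (FeasibleList.procOK F)
    ; jobOK      = AllPairs⇒lookup {SameJob⇒Disjoint} (λ {p} {q} h e → Disjoint-sym {p} {q} (h (sym e))) (FeasibleList.jobOK F)
    ; precOK     = λ a i → All⇒lookup prec i a
    }

  Ordered : List Pc → Set
  Ordered = All (λ p → start p ≤ end p)

  sumIf-timeIn-split : ∀ φ S u m v → Ordered S → u ≤ m → m ≤ v →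
    sumIf φ (timeIn u v) S ≡ sumIf φ (timeIn u m) S + sumIf φ (timeIn m v) S
  sumIf-timeIn-split φ S u m v ord u≤m m≤v =
    trans (sumIf-cong φ (timeIn u v) (λ p → timeIn u m p + timeIn m v p) S
            (All.map (λ {p} s≤e → overlapLen-split (start p) (end p) u m v s≤e u≤m m≤v) ord))
          (sumIf-+ φ (timeIn u m) (timeIn m v) S)

  -- P occupies exactly [m₁, m₂] of the window [u, v].
  module Clamped (P : Pc) (s≤e : start P ≤ end P) (u v : ℚ) (u≤v : u ≤ v) where

    m₁ m₂ : ℚ
    m₁ = clamp u v (start P)
    m₂ = clamp u v (end P)

    u≤m₁ : u ≤ m₁
    u≤m₁ = lo≤clamp u v (start P)

    m₁≤m₂ : m₁ ≤ m₂
    m₁≤m₂ = clamp-mono u v s≤e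

    m₂≤v : m₂ ≤ v
    m₂≤v = clamp≤hi u v (end P) u≤v

    timeIn-P : timeIn u v P ≡ m₂ - m₁
    timeIn-P = trans (overlapLen-comm (start P) (end P) u v) (overlapLen≡clamp-diff u v (start P) (end P) u≤v s≤e)

    split₃ : ∀ φ S → Ordered S →
      sumIf φ (timeIn u v) S ≡ sumIf φ (timeIn u m₁) S + (sumIf φ (timeIn m₁ m₂) S + sumIf φ (timeIn m₂ v) S)
    split₃ φ S ord =
      trans (sumIf-timeIn-split φ S u m₁ v ord u≤m₁ (≤-trans m₁≤m₂ m₂≤v))
            (cong (sumIf φ (timeIn u m₁) S +_) (sumIf-timeIn-split φ S m₁ m₂ v ord m₁≤m₂ m₂≤v))

    widths : (m₂ - m₁) + ((m₁ - u) + (v - m₂)) ≡ v - u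
    widths = solve 4 (λ m₁ m₂ u v → (m₂ :- m₁) :+ ((m₁ :- u) :+ (v :- m₂)) := v :- u) refl m₁ m₂ u v

    disjoint⇒timeIn-m₁m₂ : ∀ Q → Disjoint J P Q → timeIn m₁ m₂ Q ≡ 0ℚ
    disjoint⇒timeIn-m₁m₂ Q (inj₁ eP≤sQ) = overlapLen-empty (start Q) (end Q) m₁ m₂
      (≤-trans (p⊓q≤q (end Q) m₂) (subst (m₂ ≤_) (⊔-comm m₁ (start Q))
        (⊔-lub (≤-trans u≤m₁ (p≤p⊔q m₁ (start Q))) (≤-trans (p⊓q≤q v (end P)) (≤-trans eP≤sQ (p≤q⊔p m₁ (start Q)))))))
    disjoint⇒timeIn-m₁m₂ Q (inj₂ eQ≤sP) = overlapLen-empty (start Q) (end Q) m₁ m₂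
      (≤-trans (⊓-mono-≤ eQ≤sP m₂≤v)
        (≤-trans (≤-reflexive (⊓-comm (start P) v)) (≤-trans (p≤q⊔p u (v ⊓ start P)) (p≤q⊔p (start Q) m₁))))

  DisjointWhen : (Pc → Bool) → Pc → Pc → Set
  DisjointWhen φ p q = φ p ≡ true → φ q ≡ true → Disjoint J p q

  disjoint-fit : ∀ φ S → AllPairs (DisjointWhen φ) S → Ordered S →
                 ∀ u v → u ≤ v → sumIf φ (timeIn u v) S ≤ v - u
  disjoint-fit φ []      _          _          u v u≤v = p≤q⇒0≤q-p u≤v
  disjoint-fit φ (P ∷ S) (dP ∷ dS) (s≤e ∷ ord) u v u≤v with φ P in φP
  ... | false = disjoint-fit φ S dS ord u v u≤v
  ... | true  = begin
    timeIn u v P + sumIf φ (timeIn u v) S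
      ≡⟨ cong₂ _+_ timeIn-P (split₃ φ S ord) ⟩
    (m₂ - m₁) + (sumIf φ (timeIn u m₁) S + (sumIf φ (timeIn m₁ m₂) S + sumIf φ (timeIn m₂ v) S))
      ≡⟨ cong (λ z → (m₂ - m₁) + (sumIf φ (timeIn u m₁) S + (z + sumIf φ (timeIn m₂ v) S))) middle-free ⟩
    (m₂ - m₁) + (sumIf φ (timeIn u m₁) S + (0ℚ + sumIf φ (timeIn m₂ v) S))
      ≤⟨ +-monoʳ-≤ (m₂ - m₁) (+-mono-≤ (disjoint-fit φ S dS ord u m₁ u≤m₁)
                                        (≤-trans (≤-reflexive (+-identityˡ _)) (disjoint-fit φ S dS ord m₂ v m₂≤v))) ⟩
    (m₂ - m₁) + ((m₁ - u) + (v - m₂))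
      ≡⟨ widths ⟩
    v - u ∎
    where
    open Clamped P s≤e u v u≤v
    open ≤-Reasoning hiding (start)
    middle-free : sumIf φ (timeIn m₁ m₂) S ≡ 0ℚ
    middle-free = ≤-antisym
      (sumIf-nonpos φ (timeIn m₁ m₂) S (All.map (λ {Q} d φQ → ≤-reflexive (disjoint⇒timeIn-m₁m₂ Q (d refl φQ))) dP))
      (sumIf-nonneg φ (timeIn m₁ m₂) S (timeIn-nonneg m₁ m₂ S))

  record FreeWindow (φ : Pc → Bool) (S : List Pc) (u v : ℚ) : Set where
    field
      lo hi  : ℚ
      u≤lo   : u ≤ lo
      lo<hi  : lo < hi
      hi≤v   : hi ≤ v
      avoids : Avoids φ lo hi S

  module _ {φ : Pc → Bool} {P : Pc} {S : List Pc} (s≤e : start P ≤ end P) (ord : Ordered S)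
           {u v : ℚ} (u≤v : u ≤ v) where
    open Clamped P s≤e u v u≤v

    private
      below : FreeWindow φ S u m₁ → FreeWindow φ (P ∷ S) u v
      below W = record
        { lo = lo ; hi = hi ; u≤lo = u≤lo ; lo<hi = lo<hi ; hi≤v = ≤-trans hi≤m₁ (≤-trans m₁≤m₂ m₂≤v)
        ; avoids = (λ _ → inj₂ (≤-trans hi≤m₁ (clamp≤arg u v (start P) (≤-<-trans u≤lo (<-≤-trans lo<hi hi≤m₁))))) ∷ avoids }
        where open FreeWindow W renaming (hi≤v to hi≤m₁)

      above : FreeWindow φ S m₂ v → FreeWindow φ (P ∷ S) u v
      above W = record
        { lo = lo ; hi = hi ; u≤lo = ≤-trans (≤-trans u≤m₁ m₁≤m₂) m₂≤lo ; lo<hi = lo<hi ; hi≤v = hi≤v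
        ; avoids = (λ _ → inj₁ (≤-trans (arg≤clamp u v (end P) (≤-<-trans m₂≤lo (<-≤-trans lo<hi hi≤v))) m₂≤lo)) ∷ avoids }
        where open FreeWindow W renaming (u≤lo to m₂≤lo)

    window-beside : (∀ u′ v′ → sumIf φ (timeIn u′ v′) S < v′ - u′ → FreeWindow φ S u′ v′) →
                    timeIn u v P + sumIf φ (timeIn u v) S < v - u → FreeWindow φ (P ∷ S) u v
    window-beside rec lt with sumIf φ (timeIn u m₁) S <? m₁ - u | sumIf φ (timeIn m₂ v) S <? v - m₂
    ... | yes lt₁ | _       = below (rec u m₁ lt₁)
    ... | no _    | yes lt₂ = above (rec m₂ v lt₂)
    ... | no ¬lt₁ | no ¬lt₂ = ⊥-elim (<-irrefl refl (<-≤-trans lt covered))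
      where
      open ≤-Reasoning hiding (start)
      covered : v - u ≤ timeIn u v P + sumIf φ (timeIn u v) S
      covered = begin
        v - u
          ≡⟨ sym widths ⟩
        (m₂ - m₁) + ((m₁ - u) + (v - m₂))
          ≤⟨ +-monoʳ-≤ (m₂ - m₁) (+-mono-≤ (≮⇒≥ ¬lt₁) (≤-trans (≮⇒≥ ¬lt₂) (≤-reflexive (sym (+-identityˡ _))))) ⟩
        (m₂ - m₁) + (sumIf φ (timeIn u m₁) S + (0ℚ + sumIf φ (timeIn m₂ v) S))
          ≤⟨ +-monoʳ-≤ (m₂ - m₁) (+-monoʳ-≤ (sumIf φ (timeIn u m₁) S)
               (+-monoˡ-≤ (sumIf φ (timeIn m₂ v) S) (sumIf-nonneg φ (timeIn m₁ m₂) S (timeIn-nonneg m₁ m₂ S)))) ⟩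
        (m₂ - m₁) + (sumIf φ (timeIn u m₁) S + (sumIf φ (timeIn m₁ m₂) S + sumIf φ (timeIn m₂ v) S))
          ≡⟨ sym (cong₂ _+_ timeIn-P (split₃ φ S ord)) ⟩
        timeIn u v P + sumIf φ (timeIn u v) S ∎

  free-window : ∀ φ S → Ordered S → ∀ u v → sumIf φ (timeIn u v) S < v - u → FreeWindow φ S u v
  free-window φ []      _           u v lt = record
    { lo = u ; hi = v ; u≤lo = ≤-refl ; lo<hi = 0<q-p⇒p<q lt ; hi≤v = ≤-refl ; avoids = [] }
  free-window φ (P ∷ S) (s≤e ∷ ord) u v lt with φ P in φP
  ... | true  = window-beside s≤e ord (<⇒≤ u<v) (free-window φ S ord) lt
    where
    u<v : u < v
    u<v = 0<q-p⇒p<q (≤-<-trans (≤-trans (overlapLen-nonneg (start P) (end P) u v)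
                                          (p≤p+q (sumIf-nonneg φ (timeIn u v) S (timeIn-nonneg u v S)))) lt)
  ... | false = record
    { lo = lo ; hi = hi ; u≤lo = u≤lo ; lo<hi = lo<hi ; hi≤v = hi≤v
    ; avoids = (λ φP≡true → ⊥-elim (false≢true (trans (sym φP) φP≡true))) ∷ avoids }
    where open FreeWindow (free-window φ S ord u v lt)

  procs-partition : ∀ (p : Pc) → (onProc zero p ≡ true × onProc (suc zero) p ≡ false)
                                ⊎ (onProc zero p ≡ false × onProc (suc zero) p ≡ true)
  procs-partition p with proc p
  ... | zero     = inj₁ (refl , refl)
  ... | suc zero = inj₂ (refl , refl)

  sumAll≡procs : ∀ f S → sumIf (onProc zero) f S + sumIf (onProc (suc zero)) f S ≡ sumAll f S
  sumAll≡procs f S = trans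
    (sumIf-∨ (onProc zero) (onProc (suc zero)) f S (All.universal (λ p → exclusive (procs-partition p)) S))
    (sumIf-cong-filter _ _ f S (All.universal (λ p → some (procs-partition p)) S))
    where
    exclusive : ∀ {b c} → (b ≡ true × c ≡ false) ⊎ (b ≡ false × c ≡ true) → b ≡ true → c ≡ true → ⊥
    exclusive (inj₁ (_ , refl)) _ ()
    exclusive (inj₂ (refl , _)) ()
    some : ∀ {b c} → (b ≡ true × c ≡ false) ⊎ (b ≡ false × c ≡ true) → (b ∨ c) ≡ true
    some (inj₁ (refl , _)) = refl
    some (inj₂ (refl , refl)) = refl

  module FeasibleFacts {S : List Pc} (F : Feasible J S) where

    open FeasibleList (feasible⇒list F) public

    ordered : Ordered S
    ordered = All.map <⇒≤ nonempty

    precedence : PrecedenceOK S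
    precedence = All⇐lookup S (λ i a a≺ → Feasible.precOK F a i a≺)

    unit : ∀ w → sumIf (ofJob w) duration S ≡ 1ℚ
    unit w = trans (sym (len≡sumIf S w)) (Feasible.unitLength F w)

    job-disjoint : ∀ w → AllPairs (DisjointWhen (ofJob w)) S
    job-disjoint w = AllPairs.map (λ {p} {q} d op oq → d (trans (ofJob⇒≡ p op) (sym (ofJob⇒≡ q oq)))) jobOK

    proc-disjoint : ∀ i → AllPairs (DisjointWhen (onProc i)) S
    proc-disjoint i = AllPairs.map (λ {p} {q} d op oq → d (trans (onProc⇒≡ p op) (sym (onProc⇒≡ q oq)))) procOK

    job-fits : ∀ w u v → u ≤ v → sumIf (ofJob w) (timeIn u v) S ≤ v - u
    job-fits w = disjoint-fit (ofJob w) S (job-disjoint w) ordered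

    proc-fits : ∀ i u v → u ≤ v → sumIf (onProc i) (timeIn u v) S ≤ v - u
    proc-fits i = disjoint-fit (onProc i) S (proc-disjoint i) ordered

    two-processors : ∀ u v → u ≤ v → sumAll (timeIn u v) S ≤ (v - u) + (v - u)
    two-processors u v u≤v = subst (_≤ (v - u) + (v - u)) (sumAll≡procs (timeIn u v) S)
      (+-mono-≤ (proc-fits zero u v u≤v) (proc-fits (suc zero) u v u≤v))

    timeIn≤lenIn : ∀ {p w} u v → p ∈ S → job p ≡ w → timeIn u v p ≤ sumIf (ofJob w) (timeIn u v) S
    timeIn≤lenIn {p} u v p∈ jp = term≤sumIf _ (timeIn u v) S p∈ (≡⇒ofJob p jp) (timeIn-nonneg u v S)

    absent⇒lenIn≡0 : ∀ w u v → Avoids (ofJob w) u v S → sumIf (ofJob w) (timeIn u v) S ≡ 0ℚ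
    absent⇒lenIn≡0 w u v av = ≤-antisym
      (sumIf-nonpos (ofJob w) (timeIn u v) S (All.map (λ {p} h o → ≤-reflexive (overlapLen-disjoint (start p) (end p) u v (h o))) av))
      (sumIf-nonneg (ofJob w) (timeIn u v) S (timeIn-nonneg u v S))

    covered⇒lenIn≡width : ∀ {p w} → p ∈ S → job p ≡ w → ∀ u v → start p ≤ u → u ≤ v → v ≤ end p →
                          sumIf (ofJob w) (timeIn u v) S ≡ v - u
    covered⇒lenIn≡width {p} {w} p∈ jp u v sp≤u u≤v v≤ep = ≤-antisym
      (job-fits w u v u≤v)
      (≤-trans (≤-reflexive (sym (overlapLen-full (start p) (end p) u v sp≤u u≤v v≤ep))) (timeIn≤lenIn u v p∈ jp))

    filled-on-subwindow : ∀ w {x y u v} → x ≤ u → u ≤ v → v ≤ y → y - x ≤ sumIf (ofJob w) (timeIn x y) S →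
                          v - u ≤ sumIf (ofJob w) (timeIn u v) S
    filled-on-subwindow w {x} {y} {u} {v} x≤u u≤v v≤y filled = 0≤q-p⇒p≤q (subst (0ℚ ≤_) rearrange (p≤q⇒0≤q-p (≤-trans filled split)))
      where
      T : ℚ
      T = sumIf (ofJob w) (timeIn u v) S
      split : sumIf (ofJob w) (timeIn x y) S ≤ (u - x) + (T + (y - v))
      split = begin
        sumIf (ofJob w) (timeIn x y) S
          ≡⟨ sumIf-timeIn-split (ofJob w) S x u y ordered x≤u (≤-trans u≤v v≤y) ⟩
        sumIf (ofJob w) (timeIn x u) S + sumIf (ofJob w) (timeIn u y) S
          ≡⟨ cong (sumIf (ofJob w) (timeIn x u) S +_) (sumIf-timeIn-split (ofJob w) S u v y ordered u≤v v≤y) ⟩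
        sumIf (ofJob w) (timeIn x u) S + (T + sumIf (ofJob w) (timeIn v y) S)
          ≤⟨ +-mono-≤ (job-fits w x u x≤u) (+-monoʳ-≤ T (job-fits w v y v≤y)) ⟩
        (u - x) + (T + (y - v)) ∎
        where open ≤-Reasoning hiding (start)
      rearrange : ((u - x) + (T + (y - v))) - (y - x) ≡ T - (v - u)
      rearrange = solve 5 (λ T x y u v → ((u :- x) :+ (T :+ (y :- v))) :- (y :- x) := T :- (v :- u)) refl T x y u v

    three-jobs-fit : ∀ {w₁ w₂ w₃} → w₁ ≢ w₂ → w₁ ≢ w₃ → w₂ ≢ w₃ → ∀ u v → u ≤ v →
      sumIf (ofJob w₁) (timeIn u v) S + sumIf (ofJob w₂) (timeIn u v) S + sumIf (ofJob w₃) (timeIn u v) S ≤ (v - u) + (v - u)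
    three-jobs-fit {w₁} {w₂} {w₃} w₁≢w₂ w₁≢w₃ w₂≢w₃ u v u≤v = begin
      sumIf (ofJob w₁) (timeIn u v) S + sumIf (ofJob w₂) (timeIn u v) S + sumIf (ofJob w₃) (timeIn u v) S
        ≡⟨ cong (_+ sumIf (ofJob w₃) (timeIn u v) S)
                (sumIf-∨ (ofJob w₁) (ofJob w₂) (timeIn u v) S (All.universal (distinct w₁≢w₂) S)) ⟩
      sumIf one-of-two (timeIn u v) S + sumIf (ofJob w₃) (timeIn u v) S
        ≡⟨ sumIf-∨ one-of-two (ofJob w₃) (timeIn u v) S (All.universal third-distinct S) ⟩
      sumIf (λ p → one-of-two p ∨ ofJob w₃ p) (timeIn u v) S
        ≤⟨ sumIf-filter-≤ _ (λ _ → true) (timeIn u v) S (timeIn-nonneg u v S) (All.universal (λ _ _ ()) S) ⟩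
      sumAll (timeIn u v) S
        ≤⟨ two-processors u v u≤v ⟩
      (v - u) + (v - u) ∎
      where
      open ≤-Reasoning hiding (start)
      one-of-two : Pc → Bool
      one-of-two p = ofJob w₁ p ∨ ofJob w₂ p
      distinct : ∀ {w w′} → w ≢ w′ → ∀ p → ofJob w p ≡ true → ofJob w′ p ≡ true → ⊥
      distinct w≢w′ p o o′ = w≢w′ (trans (sym (ofJob⇒≡ p o)) (ofJob⇒≡ p o′))
      third-distinct : ∀ p → one-of-two p ≡ true → ofJob w₃ p ≡ true → ⊥
      third-distinct p o o₃ with ofJob w₁ p in o₁
      ... | true  = distinct w₁≢w₃ p o₁ o₃
      ... | false = distinct w₂≢w₃ p o o₃

module Surgery (J : Instance) {t₁ t₂ t₃ t₄ : ℚ} (t₁≤t₂ : t₁ Data.Rational.≤ t₂) (t₂≤t₃ : t₂ Data.Rational.≤ t₃)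
               (t₃≤t₄ : t₃ Data.Rational.≤ t₄) (σ₂ σ₄ : Fin (Instance.n J) → Maybe (Fin (Instance.n J))) where

  open import Data.Nat as ℕ using (ℕ; zero; suc; z≤n; s≤s)
  import Data.Nat.Properties as ℕ
  open import Data.Rational hiding (_≟_)
  open import Data.Rational.Properties hiding (_≟_)
  open import Data.Rational.Solver using (module +-*-Solver)
  open +-*-Solver using (solve; _:=_; _:+_; _:-_; con)
  open import Data.Maybe.Properties using (just-injective)
  import Data.List.Relation.Unary.All.Properties as All
  import Data.List.Relation.Unary.AllPairs.Properties as AllPairs
  open import Data.List.Relation.Unary.Unique.Propositional.Properties using (upTo⁺)
  open Instance J
  open Interval
  open FilteredSum
  open Schedules J

  boundary : ℕ → ℚ
  boundary 0 = t₁
  boundary 1 = t₁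
  boundary 2 = t₂
  boundary 3 = t₃
  boundary _ = t₄

  -- Part k of a piece P runs from cut P k to cut P (k + 1): parts 1 and 3 are the portions of P
  -- inside [t₁,t₂] and [t₃,t₄], reassigned to the job given by σ₂ resp. σ₄ (or dropped on nothing);
  -- the other parts keep the job of P, and parts with index ≥ 5 are empty.
  cut : Pc → ℕ → ℚ
  cut P 0 = start P
  cut P 1 = clamp (start P) (end P) t₁
  cut P 2 = clamp (start P) (end P) t₂
  cut P 3 = clamp (start P) (end P) t₃
  cut P 4 = clamp (start P) (end P) t₄
  cut P _ = end P

  relabel : ℕ → Fin n → Maybe (Fin n)
  relabel 1 = σ₂
  relabel 3 = σ₄
  relabel _ = just

  segment : ∀ {a b : ℚ} → Dec (a < b) → Maybe (Fin n) → Fin 2 → List Pc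
  segment {a} {b} (yes _) (just w) i = piece w i a b ∷ []
  segment         (yes _) nothing  i = []
  segment         (no _)  _        i = []

  part : ℕ → Pc → List Pc
  part k P = segment (cut P k <? cut P (suc k)) (relabel k (job P)) (proc P)

  parts : Pc → List Pc
  parts P = concatMap (λ k → part k P) (upTo 5)

  relabelled : List Pc → List Pc
  relabelled = concatMap parts

  record PartSpec (k : ℕ) (P q : Pc) : Set where
    field
      start≡   : start q ≡ cut P k
      end≡     : end q ≡ cut P (suc k)
      nonempty : start q < end q
      proc≡    : proc q ≡ proc P
      label≡   : relabel k (job P) ≡ just (job q)

    cut-nonempty : cut P k < cut P (suc k)
    cut-nonempty = subst₂ _<_ start≡ end≡ nonempty

  part-spec : ∀ k P {q} → q ∈ part k P → PartSpec k P q
  part-spec k P q∈ = spec (cut P k <? cut P (suc k)) (relabel k (job P)) q∈ refl refl refl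
    where
    spec : ∀ {a b} (d : Dec (a < b)) m {q} → q ∈ segment d m (proc P) → a ≡ cut P k → b ≡ cut P (suc k) →
           m ≡ relabel k (job P) → PartSpec k P q
    spec (yes a<b) (just w) (here refl) refl refl m≡ = record
      { start≡ = refl ; end≡ = refl ; nonempty = a<b ; proc≡ = refl ; label≡ = sym m≡ }

  mapsTo : Maybe (Fin n) → Fin n → Bool
  mapsTo nothing  w = false
  mapsTo (just j) w = does (j ≟ᶠ w)

  data Region (P q : Pc) : Set where
    before      : job q ≡ job P → end q ≤ t₁ → Region P q
    reassigned₂ : σ₂ (job P) ≡ just (job q) → t₁ ≤ start q → end q ≤ t₂ → Region P q
    between     : job q ≡ job P → t₂ ≤ start q → end q ≤ t₃ → Region P q
    reassigned₄ : σ₄ (job P) ≡ just (job q) → t₃ ≤ start q → end q ≤ t₄ → Region P q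
    after       : job q ≡ job P → t₄ ≤ start q → Region P q

  record PartOf (P q : Pc) : Set where
    field
      nonempty : start q < end q
      start≤   : start P ≤ start q
      ≤end     : end q ≤ end P
      proc≡    : proc q ≡ proc P
      region   : Region P q

  Compatible : Pc → Pc → Set
  Compatible p q = SameProc⇒Disjoint p q × SameJob⇒Disjoint p q


  boundary-step : ∀ k → boundary k ≤ boundary (suc k)
  boundary-step 0 = ≤-refl
  boundary-step 1 = t₁≤t₂
  boundary-step 2 = t₂≤t₃
  boundary-step 3 = t₃≤t₄
  boundary-step (suc (suc (suc (suc k)))) = ≤-refl

  boundary-mono : ∀ {i j} → i ℕ.≤ j → boundary i ≤ boundary j
  boundary-mono {i} {j} i≤j with ℕ.m≤n⇒m<n∨m≡n i≤j
  boundary-mono {i} {suc j} _ | inj₁ (s≤s i≤j) = ≤-trans (boundary-mono i≤j) (boundary-step j)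
  boundary-mono             _ | inj₂ refl      = ≤-refl

  module _ (P : Pc) (s≤e : start P ≤ end P) where
    private
      s = start P
      e = end P

    start≤cut : ∀ k → s ≤ cut P k
    start≤cut 0 = ≤-refl
    start≤cut 1 = lo≤clamp s e t₁
    start≤cut 2 = lo≤clamp s e t₂
    start≤cut 3 = lo≤clamp s e t₃
    start≤cut 4 = lo≤clamp s e t₄
    start≤cut (suc (suc (suc (suc (suc k))))) = s≤e

    cut≤end : ∀ k → cut P k ≤ e
    cut≤end 0 = s≤e
    cut≤end 1 = clamp≤hi s e t₁ s≤e
    cut≤end 2 = clamp≤hi s e t₂ s≤e
    cut≤end 3 = clamp≤hi s e t₃ s≤e
    cut≤end 4 = clamp≤hi s e t₄ s≤e
    cut≤end (suc (suc (suc (suc (suc k))))) = ≤-refl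

    cut-step : ∀ k → cut P k ≤ cut P (suc k)
    cut-step 0 = lo≤clamp s e t₁
    cut-step 1 = clamp-mono s e t₁≤t₂
    cut-step 2 = clamp-mono s e t₂≤t₃
    cut-step 3 = clamp-mono s e t₃≤t₄
    cut-step 4 = clamp≤hi s e t₄ s≤e
    cut-step (suc (suc (suc (suc (suc k))))) = ≤-refl

    nonempty⇒k≤4 : ∀ k → cut P k < cut P (suc k) → k ℕ.≤ 4
    nonempty⇒k≤4 0 _ = z≤n
    nonempty⇒k≤4 1 _ = s≤s z≤n
    nonempty⇒k≤4 2 _ = s≤s (s≤s z≤n)
    nonempty⇒k≤4 3 _ = s≤s (s≤s (s≤s z≤n))
    nonempty⇒k≤4 4 _ = s≤s (s≤s (s≤s (s≤s z≤n)))
    nonempty⇒k≤4 (suc (suc (suc (suc (suc k))))) h = ⊥-elim (<-irrefl refl h)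

    boundary≤cut : ∀ k → 1 ℕ.≤ k → cut P k < cut P (suc k) → boundary k ≤ cut P k
    boundary≤cut 1 _ h = arg≤clamp s e t₁ (<-≤-trans h (cut≤end 2))
    boundary≤cut 2 _ h = arg≤clamp s e t₂ (<-≤-trans h (cut≤end 3))
    boundary≤cut 3 _ h = arg≤clamp s e t₃ (<-≤-trans h (cut≤end 4))
    boundary≤cut 4 _ h = arg≤clamp s e t₄ h
    boundary≤cut (suc (suc (suc (suc (suc k))))) _ h = ⊥-elim (<-irrefl refl h)

    cut≤boundary : ∀ k → k ℕ.≤ 3 → cut P k < cut P (suc k) → cut P (suc k) ≤ boundary (suc k)
    cut≤boundary 0 _ h = clamp≤arg s e t₁ h
    cut≤boundary 1 _ h = clamp≤arg s e t₂ (≤-<-trans (start≤cut 1) h)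
    cut≤boundary 2 _ h = clamp≤arg s e t₃ (≤-<-trans (start≤cut 2) h)
    cut≤boundary 3 _ h = clamp≤arg s e t₄ (≤-<-trans (start≤cut 3) h)
    cut≤boundary (suc (suc (suc (suc k)))) (s≤s (s≤s (s≤s ()))) h

  part-of : ∀ k P {q} → start P ≤ end P → q ∈ part k P → PartOf P q
  part-of k P {q} s≤e q∈ = record
    { nonempty = nonempty
    ; start≤   = ≤-trans (start≤cut P s≤e k) (≤-reflexive (sym start≡))
    ; ≤end     = ≤-trans (≤-reflexive end≡) (cut≤end P s≤e (suc k))
    ; proc≡    = proc≡
    ; region   = region k label≡ (≤-trans (≤-reflexive end≡) ∘ upper) (λ 1≤k → ≤-trans (lower 1≤k) (≤-reflexive (sym start≡)))
    }
    where
    open PartSpec (part-spec k P q∈)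
    upper : k ℕ.≤ 3 → cut P (suc k) ≤ boundary (suc k)
    upper k≤3 = cut≤boundary P s≤e k k≤3 cut-nonempty
    lower : 1 ℕ.≤ k → boundary k ≤ cut P k
    lower 1≤k = boundary≤cut P s≤e k 1≤k cut-nonempty
    region : ∀ k′ → relabel k′ (job P) ≡ just (job q) → (k′ ℕ.≤ 3 → end q ≤ boundary (suc k′)) →
             (1 ℕ.≤ k′ → boundary k′ ≤ start q) → Region P q
    region 0 l hi lo = before (sym (just-injective l)) (hi z≤n)
    region 1 l hi lo = reassigned₂ l (lo (s≤s z≤n)) (hi (s≤s z≤n))
    region 2 l hi lo = between (sym (just-injective l)) (lo (s≤s z≤n)) (hi (s≤s (s≤s z≤n)))
    region 3 l hi lo = reassigned₄ l (lo (s≤s z≤n)) (hi (s≤s (s≤s (s≤s z≤n))))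
    region (suc (suc (suc (suc k′)))) l hi lo = after (sym (just-injective l)) (lo (s≤s z≤n))

  parts-ordered : ∀ {k₁ k₂ P₁ P₂ q₁ q₂} → start P₁ ≤ end P₁ → start P₂ ≤ end P₂ → k₁ ℕ.< k₂ →
                  q₁ ∈ part k₁ P₁ → q₂ ∈ part k₂ P₂ → end q₁ ≤ start q₂
  parts-ordered {k₁} {k₂} {P₁} {P₂} {q₁} {q₂} s≤e₁ s≤e₂ k₁<k₂ q₁∈ q₂∈ = begin
    end q₁             ≡⟨ end≡ spec₁ ⟩
    cut P₁ (suc k₁)    ≤⟨ cut≤boundary P₁ s≤e₁ k₁ k₁≤3 (cut-nonempty spec₁) ⟩
    boundary (suc k₁)  ≤⟨ boundary-mono k₁<k₂ ⟩
    boundary k₂        ≤⟨ boundary≤cut P₂ s≤e₂ k₂ (ℕ.≤-trans (s≤s z≤n) k₁<k₂) (cut-nonempty spec₂) ⟩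
    cut P₂ k₂          ≡⟨ sym (start≡ spec₂) ⟩
    start q₂           ∎
    where
    open ≤-Reasoning hiding (start)
    open PartSpec
    spec₁ = part-spec k₁ P₁ q₁∈
    spec₂ = part-spec k₂ P₂ q₂∈
    k₁≤3 : k₁ ℕ.≤ 3
    k₁≤3 = ℕ.≤-pred (ℕ.≤-trans k₁<k₂ (nonempty⇒k≤4 P₂ s≤e₂ k₂ (cut-nonempty spec₂)))

  parts-disjoint : ∀ {P₁ P₂ q₁ q₂} → PartOf P₁ q₁ → PartOf P₂ q₂ → Disjoint J P₁ P₂ → Disjoint J q₁ q₂
  parts-disjoint p₁ p₂ (inj₁ e₁≤s₂) = inj₁ (≤-trans (PartOf.≤end p₁) (≤-trans e₁≤s₂ (PartOf.start≤ p₂)))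
  parts-disjoint p₁ p₂ (inj₂ e₂≤s₁) = inj₂ (≤-trans (PartOf.≤end p₂) (≤-trans e₂≤s₁ (PartOf.start≤ p₁)))

  all-in-parts : ∀ P {X : Pc → Set} → (∀ k {q} → q ∈ part k P → X q) → All X (parts P)
  all-in-parts P h = All.concat⁺ (All.map⁺ (All.universal (λ k → All.tabulate (h k)) (upTo 5)))

  all-relabelled : ∀ {S} {X : Pc → Set} → Ordered S → All (λ P → ∀ {q} → PartOf P q → X q) S → All X (relabelled S)
  all-relabelled ord h =
    All.concat⁺ (All.map⁺ (All.zipWith (λ {P} (s≤e , hP) → all-in-parts P (λ k q∈ → hP (part-of k P s≤e q∈))) (ord , h)))

  relabelled-nonempty : ∀ S → Ordered S → All (λ q → start q < end q) (relabelled S)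
  relabelled-nonempty S ord = all-relabelled ord (All.universal (λ P {q} → PartOf.nonempty) S)

  module Pairwise (σ₂-injective : ∀ {i j w} → σ₂ i ≡ just w → σ₂ j ≡ just w → i ≡ j)
                  (σ₄-injective : ∀ {i j w} → σ₄ i ≡ just w → σ₄ j ≡ just w → i ≡ j) where

    relabel-injective : ∀ k {i j w} → relabel k i ≡ just w → relabel k j ≡ just w → i ≡ j
    relabel-injective 0 hi hj = just-injective (trans hi (sym hj))
    relabel-injective 1 = σ₂-injective
    relabel-injective 2 hi hj = just-injective (trans hi (sym hj))
    relabel-injective 3 = σ₄-injective
    relabel-injective (suc (suc (suc (suc k)))) hi hj = just-injective (trans hi (sym hj))

    part-compatible : ∀ {k₁ k₂ P₁ P₂ q₁ q₂} → start P₁ ≤ end P₁ → start P₂ ≤ end P₂ →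
                      k₁ ≢ k₂ ⊎ (k₁ ≡ k₂ × Compatible P₁ P₂) → q₁ ∈ part k₁ P₁ → q₂ ∈ part k₂ P₂ → Compatible q₁ q₂
    part-compatible {k₁} {k₂} s≤e₁ s≤e₂ (inj₁ k₁≢k₂) q₁∈ q₂∈ with ℕ.<-cmp k₁ k₂
    ... | tri< k₁<k₂ _ _ = let d = inj₁ (parts-ordered s≤e₁ s≤e₂ k₁<k₂ q₁∈ q₂∈) in (λ _ → d) , (λ _ → d)
    ... | tri≈ _ k₁≡k₂ _ = ⊥-elim (k₁≢k₂ k₁≡k₂)
    ... | tri> _ _ k₂<k₁ = let d = inj₂ (parts-ordered s≤e₂ s≤e₁ k₂<k₁ q₂∈ q₁∈) in (λ _ → d) , (λ _ → d)
    part-compatible {k} {_} {P₁} {P₂} s≤e₁ s≤e₂ (inj₂ (refl , sameProc , sameJob)) q₁∈ q₂∈ =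
      (λ e → parts-disjoint of₁ of₂ (sameProc (trans (sym (PartOf.proc≡ of₁)) (trans e (PartOf.proc≡ of₂))))) ,
      (λ e → parts-disjoint of₁ of₂ (sameJob (relabel-injective k (PartSpec.label≡ (part-spec k P₁ q₁∈))
                                                (trans (PartSpec.label≡ (part-spec k P₂ q₂∈)) (cong just (sym e))))))
      where
      of₁ = part-of k P₁ s≤e₁ q₁∈
      of₂ = part-of k P₂ s≤e₂ q₂∈

    segment-pairs : ∀ {R : Pc → Pc → Set} {a b} (d : Dec (a < b)) m i → AllPairs R (segment d m i)
    segment-pairs (yes _) (just w) i = [] ∷ []
    segment-pairs (yes _) nothing  i = []
    segment-pairs (no _)  _        i = []

    relabelled-compatible : ∀ {S} → Ordered S → AllPairs Compatible S → AllPairs Compatible (relabelled S)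
    relabelled-compatible {S} ord cS =
      AllPairs.concat⁺ (All.map⁺ (All.map (λ {P} → within P) ord)) (AllPairs.map⁺ (AllPairs.map across (with-order ord cS)))
      where
      within : ∀ P → start P ≤ end P → AllPairs Compatible (parts P)
      within P s≤e =
        AllPairs.concat⁺
          (All.map⁺ (All.universal (λ k → segment-pairs (cut P k <? cut P (suc k)) (relabel k (job P)) (proc P)) (upTo 5)))
                         (AllPairs.map⁺ {f = λ k → part k P} (AllPairs.map (λ k₁≢k₂ → All.tabulate (λ q₁∈ → All.tabulate (λ q₂∈ →
                            part-compatible s≤e s≤e (inj₁ k₁≢k₂) q₁∈ q₂∈))) (upTo⁺ 5)))
      across : ∀ {P₁ P₂} → (start P₁ ≤ end P₁) × (start P₂ ≤ end P₂) × Compatible P₁ P₂ →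
               All (λ q₁ → All (Compatible q₁) (parts P₂)) (parts P₁)
      across {P₁} {P₂} (s≤e₁ , s≤e₂ , c) = all-in-parts P₁ (λ k₁ q₁∈ → all-in-parts P₂ (λ k₂ q₂∈ →
        part-compatible s≤e₁ s≤e₂ (same-or-not k₁ k₂) q₁∈ q₂∈))
        where
        same-or-not : ∀ k₁ k₂ → k₁ ≢ k₂ ⊎ (k₁ ≡ k₂ × Compatible P₁ P₂)
        same-or-not k₁ k₂ with k₁ ℕ.≟ k₂
        ... | yes k₁≡k₂ = inj₂ (k₁≡k₂ , c)
        ... | no  k₁≢k₂ = inj₁ k₁≢k₂
      with-order : ∀ {L} → Ordered L → AllPairs Compatible L →
                   AllPairs (λ P₁ P₂ → (start P₁ ≤ end P₁) × (start P₂ ≤ end P₂) × Compatible P₁ P₂) L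
      with-order []           []         = []
      with-order (s≤e ∷ ord′) (c ∷ cs) =
        All.zipWith (λ (s≤e′ , c′) → s≤e , s≤e′ , c′) (ord′ , c) ∷ with-order ord′ cs

  private
    when : Bool → ℚ → ℚ
    when b x = if b then x else 0ℚ

    sumIf-concatMap : ∀ {A : Set} φ f (g : A → List Pc) xs → sumIf φ f (concatMap g xs) ≡ sumAll (λ x → sumIf φ f (g x)) xs
    sumIf-concatMap φ f g []       = refl
    sumIf-concatMap φ f g (x ∷ xs) =
      trans (sumIf-++ φ f (g x) (concatMap g xs)) (cong (sumIf φ f (g x) +_) (sumIf-concatMap φ f g xs))

  I₂ I₄ : Pc → ℚ
  I₂ = timeIn t₁ t₂
  I₄ = timeIn t₃ t₄

  into₂ into₄ : Fin n → Pc → Bool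
  into₂ w P = mapsTo (σ₂ (job P)) w
  into₄ w P = mapsTo (σ₄ (job P)) w

  part-duration : ∀ k P w → start P ≤ end P →
                  sumIf (ofJob w) duration (part k P) ≡ when (mapsTo (relabel k (job P)) w) (cut P (suc k) - cut P k)
  part-duration k P w s≤e with cut P k <? cut P (suc k) | relabel k (job P)
  ... | yes _ | just j with does (j ≟ᶠ w)
  ...   | true  = +-identityʳ _
  ...   | false = refl
  part-duration k P w s≤e | yes _ | nothing = refl
  part-duration k P w s≤e | no ≮ | m with mapsTo m w
  ...   | false = refl
  ...   | true  = sym (trans (cong (_- cut P k) (≤-antisym (≮⇒≥ ≮) (cut-step P s≤e k))) (+-inverseʳ (cut P k)))

  parts-duration : ∀ P w → start P ≤ end P → sumIf (ofJob w) duration (parts P) ≡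
                   when (ofJob w P) (duration P - I₂ P - I₄ P) + (when (into₂ w P) (I₂ P) + when (into₄ w P) (I₄ P))
  parts-duration P w s≤e
    rewrite sumIf-concatMap (ofJob w) duration (λ k → part k P) (upTo 5)
          | part-duration 0 P w s≤e | part-duration 1 P w s≤e | part-duration 2 P w s≤e
          | part-duration 3 P w s≤e | part-duration 4 P w s≤e
          | overlapLen≡clamp-diff (start P) (end P) t₁ t₂ s≤e t₁≤t₂
          | overlapLen≡clamp-diff (start P) (end P) t₃ t₄ s≤e t₃≤t₄
    = trans (regroup (when (ofJob w P) (cut P 1 - cut P 0)) (when (into₂ w P) (cut P 2 - cut P 1))
                     (when (ofJob w P) (cut P 3 - cut P 2)) (when (into₄ w P) (cut P 4 - cut P 3))
                     (when (ofJob w P) (cut P 5 - cut P 4)))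
            (cong (_+ (when (into₂ w P) (cut P 2 - cut P 1) + when (into₄ w P) (cut P 4 - cut P 3)))
                  (telescope (ofJob w P) (cut P 0) (cut P 1) (cut P 2) (cut P 3) (cut P 4) (cut P 5)))
    where
    regroup : ∀ a b c d e → a + (b + (c + (d + (e + 0ℚ)))) ≡ (a + c + e) + (b + d)
    regroup = solve 5 (λ a b c d e → a :+ (b :+ (c :+ (d :+ (e :+ con 0ℚ)))) := (a :+ c :+ e) :+ (b :+ d)) refl
    telescope : ∀ b c₀ c₁ c₂ c₃ c₄ c₅ →
      when b (c₁ - c₀) + when b (c₃ - c₂) + when b (c₅ - c₄) ≡ when b (c₅ - c₀ - (c₂ - c₁) - (c₄ - c₃))
    telescope true  =
      solve 6 (λ c₀ c₁ c₂ c₃ c₄ c₅ → (c₁ :- c₀) :+ (c₃ :- c₂) :+ (c₅ :- c₄) := c₅ :- c₀ :- (c₂ :- c₁) :- (c₄ :- c₃)) refl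
    telescope false _ _ _ _ _ _ = trans (+-identityʳ _) (+-identityʳ _)

  relabelled-duration : ∀ S w → Ordered S → sumIf (ofJob w) duration (relabelled S) ≡
    (sumIf (ofJob w) duration S - sumIf (ofJob w) I₂ S - sumIf (ofJob w) I₄ S) + (sumIf (into₂ w) I₂ S + sumIf (into₄ w) I₄ S)
  relabelled-duration S w ord = begin
    sumIf (ofJob w) duration (relabelled S)
      ≡⟨ sumIf-concatMap (ofJob w) duration parts S ⟩
    sumAll (λ P → sumIf (ofJob w) duration (parts P)) S
      ≡⟨ sumIf-cong _ _ _ S (All.map (λ {P} → parts-duration P w) ord) ⟩
    sumAll (λ P → when (ofJob w P) (duration P - I₂ P - I₄ P) + (when (into₂ w P) (I₂ P) + when (into₄ w P) (I₄ P))) S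
      ≡⟨ sumIf-+ _ (λ P → when (ofJob w P) (duration P - I₂ P - I₄ P)) _ S ⟩
    sumAll (λ P → when (ofJob w P) (duration P - I₂ P - I₄ P)) S + sumAll (λ P → when (into₂ w P) (I₂ P) + when (into₄ w P) (I₄ P)) S
      ≡⟨ cong₂ _+_ (sumAll-indicator (ofJob w) _ S)
                   (trans (sumIf-+ _ (λ P → when (into₂ w P) (I₂ P)) _ S)
                          (cong₂ _+_ (sumAll-indicator (into₂ w) I₂ S) (sumAll-indicator (into₄ w) I₄ S))) ⟩
    sumIf (ofJob w) (λ P → duration P - I₂ P - I₄ P) S + (sumIf (into₂ w) I₂ S + sumIf (into₄ w) I₄ S)
      ≡⟨ cong (_+ (sumIf (into₂ w) I₂ S + sumIf (into₄ w) I₄ S))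
           (trans (sumIf-- (ofJob w) (λ P → duration P - I₂ P) I₄ S)
                  (cong (_- sumIf (ofJob w) I₄ S) (sumIf-- (ofJob w) duration I₂ S))) ⟩
    (sumIf (ofJob w) duration S - sumIf (ofJob w) I₂ S - sumIf (ofJob w) I₄ S) + (sumIf (into₂ w) I₂ S + sumIf (into₄ w) I₄ S) ∎
    where open ≡-Reasoning

module Exchange (J : Instance) where

  open import Data.Rational hiding (_≟_)
  open import Data.Rational.Properties hiding (_≟_)
  open import Data.Rational.Solver using (module +-*-Solver)
  open +-*-Solver using (solve; _:=_; _:+_; _:-_; con)
  open import Data.List.Membership.Propositional.Properties using (∈-allFin)
  open import Data.Fin.Permutation.Components using (transpose; transpose-inverse)
  open import Data.Maybe.Properties using (just-injective)
  open Instance J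
  open Interval
  open FilteredSum
  open Schedules J

  private
    sum-< : ∀ (f g : Fin n → ℚ) L {a} → a ∈ L → (∀ w → f w ≤ g w) → f a < g a →
            foldr (λ w acc → f w + acc) 0ℚ L < foldr (λ w acc → g w + acc) 0ℚ L
    sum-< f g (w ∷ L) (here refl) f≤g fa<ga = +-mono-<-≤ fa<ga (sum-≤ L)
      where
      sum-≤ : ∀ L → foldr (λ w acc → f w + acc) 0ℚ L ≤ foldr (λ w acc → g w + acc) 0ℚ L
      sum-≤ []      = ≤-refl
      sum-≤ (w ∷ L) = +-mono-≤ (f≤g w) (sum-≤ L)
    sum-< f g (w ∷ L) (there a∈) f≤g fa<ga = +-mono-≤-< (f≤g w) (sum-< f g L a∈ f≤g fa<ga)

  transpose-cases : ∀ {m} (i j k : Fin m) →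
    (k ≡ i × transpose i j k ≡ j) ⊎ (k ≡ j × transpose i j k ≡ i) ⊎ (k ≢ i × transpose i j k ≡ k)
  transpose-cases i j k with k ≟ᶠ i
  ... | yes k≡i = inj₁ (k≡i , refl)
  ... | no k≢i with k ≟ᶠ j
  ...   | yes k≡j = inj₂ (inj₁ (k≡j , refl))
  ...   | no _    = inj₂ (inj₂ (k≢i , refl))

  optimal-unimprovable : ∀ {S S′} → Optimal J S → Feasible J S′ → (∀ w → C J S′ w ≤ C J S w) →
                         ∀ a → ¬ C J S′ a < C J S a
  optimal-unimprovable {S} {S′} (_ , best) F′ C′≤C a C′a<Ca =
    <-irrefl refl (<-≤-trans (sum-< (C J S′) (C J S) (allFin n) (∈-allFin a) C′≤C C′a<Ca) (best S′ F′))

  -- The last δ units [C(a) - δ, C(a)] of a may be run in [u, u + δ] instead.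
  record EarlierSlot (S : List Pc) (a : Fin n) : Set where
    field
      last-of-a        : LastPiece S a
      u δ              : ℚ
      0<δ              : 0ℚ < δ
      slot<tail        : u + δ ≤ C J S a - δ
      last-covers-tail : start (LastPiece.last last-of-a) ≤ C J S a - δ
      a-absent         : Avoids (ofJob a) u (u + δ) S
      a-preds-done     : ∀ d → _≺_ J d a → C J S d ≤ u
      a-released       : r J a ≤ u

  module WithSlot {S} (opt : Optimal J S) {a} (slot : EarlierSlot S a) where
    open EarlierSlot slot
    open LastPiece last-of-a
    open FeasibleFacts (proj₁ opt)

    Ca t₁ t₂ t₃ t₄ : ℚ
    Ca = C J S a
    t₁ = u
    t₂ = u + δ
    t₃ = Ca - δ
    t₄ = Ca

    t₁<t₂ : t₁ < t₂
    t₁<t₂ = p<p+q u 0<δ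

    t₁≤t₂ : t₁ ≤ t₂
    t₁≤t₂ = <⇒≤ t₁<t₂

    t₂≤t₃ : t₂ ≤ t₃
    t₂≤t₃ = slot<tail

    t₃<t₄ : t₃ < t₄
    t₃<t₄ = subst (Ca - δ <_) (+-identityʳ Ca) (+-monoʳ-< Ca (neg-antimono-< 0<δ))

    t₃≤t₄ : t₃ ≤ t₄
    t₃≤t₄ = <⇒≤ t₃<t₄

    t₁≤t₃ : t₁ ≤ t₃
    t₁≤t₃ = ≤-trans t₁≤t₂ t₂≤t₃

    0≤t₃ : 0ℚ ≤ t₃
    0≤t₃ = ≤-trans (r-nonneg a) (≤-trans a-released t₁≤t₃)

    a-absent-early : sumIf (ofJob a) (timeIn t₁ t₂) S ≡ 0ℚ
    a-absent-early = absent⇒lenIn≡0 a t₁ t₂ a-absent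

    a-fills-tail : sumIf (ofJob a) (timeIn t₃ t₄) S ≡ δ
    a-fills-tail = trans (covered⇒lenIn≡width last∈ job-last t₃ t₄ last-covers-tail t₃≤t₄ (≤-reflexive (sym end-last)))
                         (solve 2 (λ c δ → c :- (c :- δ) := δ) refl Ca δ)

    a-done-by-t₄ : ∀ {P s e} → P ∈ S → job P ≡ a → s < e → e ≤ end P → ¬ t₄ ≤ s
    a-done-by-t₄ P∈ jP s<e e≤eP t₄≤s = <-irrefl refl (≤-<-trans t₄≤s (<-≤-trans s<e (≤-trans e≤eP (end≤C P∈ jP))))

    -- a takes over q's time in [t₁, t₂] and q takes over a's time in [t₃, t₄].
    module Swap {q} (a≢q : a ≢ q) {Q} (Q∈ : Q ∈ S) (job-Q : job Q ≡ q) (Q-from : start Q ≤ t₁) (Q-to : t₂ ≤ end Q)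
                (q-absent-tail : Avoids (ofJob q) t₃ t₄ S) (Ca≤Cq : Ca ≤ C J S q) where

      τ : Fin n → Fin n
      τ = transpose a q

      σ : Fin n → Maybe (Fin n)
      σ j = just (τ j)

      σ-injective : ∀ {i j w} → σ i ≡ just w → σ j ≡ just w → i ≡ j
      σ-injective {i} {j} σi σj = begin
        i                          ≡⟨ sym (transpose-inverse q a) ⟩
        transpose q a (τ i)        ≡⟨ cong (transpose q a) (just-injective (trans σi (sym σj))) ⟩
        transpose q a (τ j)        ≡⟨ transpose-inverse q a ⟩
        j                          ∎
        where open ≡-Reasoning

      open Surgery J t₁≤t₂ t₂≤t₃ t₃≤t₄ σ σ
      open Pairwise σ-injective σ-injective

      S′ : List Pc
      S′ = relabelled S

      job-swapped : ∀ {j w} → τ j ≡ w → (j ≢ a × w ≡ j) ⊎ (j ≡ a × w ≡ q) ⊎ (j ≡ q × w ≡ a)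
      job-swapped {j} refl with transpose-cases a q j
      ... | inj₁ (j≡a , τj≡q)         = inj₂ (inj₁ (j≡a , τj≡q))
      ... | inj₂ (inj₁ (j≡q , τj≡a))  = inj₂ (inj₂ (j≡q , τj≡a))
      ... | inj₂ (inj₂ (j≢a , τj≡j))  = inj₁ (j≢a , τj≡j)

      into≡ofJob : ∀ w P → mapsTo (σ (job P)) w ≡ ofJob (transpose q a w) P
      into≡ofJob w P with τ (job P) ≟ᶠ w | job P ≟ᶠ transpose q a w
      ... | yes _    | yes _    = refl
      ... | no _     | no _     = refl
      ... | yes τj≡w | no j≢τ⁻w = ⊥-elim (j≢τ⁻w (trans (sym (transpose-inverse q a)) (cong (transpose q a) τj≡w)))
      ... | no τj≢w  | yes j≡τ⁻w = ⊥-elim (τj≢w (trans (cong τ j≡τ⁻w) (transpose-inverse a q)))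

      L₂ L₄ : Fin n → ℚ
      L₂ w = sumIf (ofJob w) I₂ S
      L₄ w = sumIf (ofJob w) I₄ S

      q-fills-slot : L₂ q ≡ δ
      q-fills-slot = trans (covered⇒lenIn≡width Q∈ job-Q t₁ t₂ Q-from t₁≤t₂ Q-to) (solve 2 (λ u δ → (u :+ δ) :- u := δ) refl u δ)

      q-absent-from-tail : L₄ q ≡ 0ℚ
      q-absent-from-tail = absent⇒lenIn≡0 q t₃ t₄ q-absent-tail

      δ-exchanged : L₂ q + L₄ q ≡ L₂ a + L₄ a
      δ-exchanged = begin
        L₂ q + L₄ q  ≡⟨ cong₂ _+_ q-fills-slot q-absent-from-tail ⟩
        δ + 0ℚ       ≡⟨ +-comm δ 0ℚ ⟩
        0ℚ + δ       ≡⟨ sym (cong₂ _+_ a-absent-early a-fills-tail) ⟩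
        L₂ a + L₄ a  ∎
        where open ≡-Reasoning

      balance : ∀ w → L₂ w + L₄ w ≡ L₂ (transpose q a w) + L₄ (transpose q a w)
      balance w with transpose-cases q a w
      ... | inj₁ (refl , τ⁻w≡a)        rewrite τ⁻w≡a = δ-exchanged
      ... | inj₂ (inj₁ (refl , τ⁻w≡q)) rewrite τ⁻w≡q = sym δ-exchanged
      ... | inj₂ (inj₂ (_ , τ⁻w≡w))    = cong (λ v → L₂ v + L₄ v) (sym τ⁻w≡w)

      unit′ : ∀ w → len J S′ w ≡ 1ℚ
      unit′ w = begin
        len J S′ w
          ≡⟨ len≡sumIf S′ w ⟩
        sumIf (ofJob w) duration S′
          ≡⟨ relabelled-duration S w ordered ⟩
        (sumIf (ofJob w) duration S - L₂ w - L₄ w) + (sumIf (into₂ w) I₂ S + sumIf (into₄ w) I₄ S)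
          ≡⟨ cong₂ (λ x y → (x - L₂ w - L₄ w) + y) (unit w)
                   (cong₂ _+_ (sumIf-cong-filter _ _ I₂ S (All.universal (into≡ofJob w) S))
                              (sumIf-cong-filter _ _ I₄ S (All.universal (into≡ofJob w) S))) ⟩
        (1ℚ - L₂ w - L₄ w) + (L₂ (transpose q a w) + L₄ (transpose q a w))
          ≡⟨ cong ((1ℚ - L₂ w - L₄ w) +_) (sym (balance w)) ⟩
        (1ℚ - L₂ w - L₄ w) + (L₂ w + L₄ w)
          ≡⟨ solve 2 (λ x y → (con 1ℚ :- x :- y) :+ (x :+ y) := con 1ℚ) refl (L₂ w) (L₄ w) ⟩
        1ℚ ∎
        where open ≡-Reasoning

      inherited : (X : Fin n → ℚ → Set) → (∀ {w s s′} → s ≤ s′ → X w s → X w s′) →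
                  All (λ P → X (job P) (start P)) S → X a t₁ → X q t₁ → All (λ p → X (job p) (start p)) S′
      inherited X later hS Xa Xq = all-relabelled ordered (All.map (λ {P} XP {q′} part → from-part P XP part (PartOf.region part)) hS)
        where
        same-job : ∀ P {q′} → X (job P) (start P) → PartOf P q′ → job q′ ≡ job P → X (job q′) (start q′)
        same-job P XP part e = subst (λ j → X j _) (sym e) (later (PartOf.start≤ part) XP)
        swapped : ∀ P {q′} → X (job P) (start P) → PartOf P q′ → τ (job P) ≡ job q′ → t₁ ≤ start q′ → X (job q′) (start q′)
        swapped P XP part τj≡ t₁≤s with job-swapped τj≡
        ... | inj₁ (_ , e)         = same-job P XP part e
        ... | inj₂ (inj₁ (_ , e)) = subst (λ j → X j _) (sym e) (later t₁≤s Xq)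
        ... | inj₂ (inj₂ (_ , e)) = subst (λ j → X j _) (sym e) (later t₁≤s Xa)
        from-part : ∀ P {q′} → X (job P) (start P) → PartOf P q′ → Region P q′ → X (job q′) (start q′)
        from-part P XP part (before e _)            = same-job P XP part e
        from-part P XP part (reassigned₂ l t₁≤s _)  = swapped P XP part (just-injective l) t₁≤s
        from-part P XP part (between e _ _)         = same-job P XP part e
        from-part P XP part (reassigned₄ l t₃≤s _)  = swapped P XP part (just-injective l) (≤-trans t₁≤t₃ t₃≤s)
        from-part P XP part (after e _)             = same-job P XP part e

      C′≤C : ∀ w → C J S′ w ≤ C J S w
      C′≤C w = C≤⇒ S′ (C-nonneg S w)
        (all-relabelled ordered (All.tabulate (λ {P} P∈ {q′} part jq′ → bound P∈ part (PartOf.region part) jq′)))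
        where
        via-P : ∀ {P q′} → P ∈ S → PartOf P q′ → end P ≤ C J S w → end q′ ≤ C J S w
        via-P P∈ part eP≤ = ≤-trans (PartOf.≤end part) eP≤
        swapped : ∀ {P q′} → P ∈ S → PartOf P q′ → τ (job P) ≡ job q′ → end q′ ≤ t₄ → job q′ ≡ w → end q′ ≤ C J S w
        swapped {q′ = q′} P∈ part τj≡ eq′≤t₄ jq′ with job-swapped τj≡
        ... | inj₁ (_ , e)              = via-P P∈ part (end≤C P∈ (trans (sym e) jq′))
        ... | inj₂ (inj₁ (jP≡a , e))    =
          via-P P∈ part (≤-trans (end≤C P∈ jP≡a) (subst (λ j → Ca ≤ C J S j) (trans (sym e) jq′) Ca≤Cq))
        ... | inj₂ (inj₂ (_ , e))       = subst (λ j → end q′ ≤ C J S j) (trans (sym e) jq′) eq′≤t₄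
        bound : ∀ {P q′} → P ∈ S → PartOf P q′ → Region P q′ → job q′ ≡ w → end q′ ≤ C J S w
        bound P∈ part (before e _)              jq′ = via-P P∈ part (end≤C P∈ (trans (sym e) jq′))
        bound P∈ part (reassigned₂ l _ eq′≤t₂)  jq′ = swapped P∈ part (just-injective l) (≤-trans eq′≤t₂ (≤-trans t₂≤t₃ t₃≤t₄)) jq′
        bound P∈ part (between e _ _)           jq′ = via-P P∈ part (end≤C P∈ (trans (sym e) jq′))
        bound P∈ part (reassigned₄ l _ eq′≤t₄)  jq′ = swapped P∈ part (just-injective l) eq′≤t₄ jq′
        bound P∈ part (after e _)               jq′ = via-P P∈ part (end≤C P∈ (trans (sym e) jq′))

      C′a≤t₃ : C J S′ a ≤ t₃
      C′a≤t₃ = C≤⇒ S′ 0≤t₃ (all-relabelled ordered (All.tabulate (λ {P} P∈ {q′} part jq′ → bound P∈ part (PartOf.region part) jq′)))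
        where
        bound : ∀ {P q′} → P ∈ S → PartOf P q′ → Region P q′ → job q′ ≡ a → end q′ ≤ t₃
        bound P∈ part (before _ eq′≤t₁)        _   = ≤-trans eq′≤t₁ t₁≤t₃
        bound P∈ part (reassigned₂ _ _ eq′≤t₂) _   = ≤-trans eq′≤t₂ t₂≤t₃
        bound P∈ part (between _ _ eq′≤t₃)     _   = eq′≤t₃
        bound {P} P∈ part (reassigned₄ l _ eq′≤t₄) jq′ with job-swapped (just-injective l)
        ... | inj₁ (jP≢a , e)         = ⊥-elim (jP≢a (trans (sym e) jq′))
        ... | inj₂ (inj₁ (_ , e))     = ⊥-elim (a≢q (trans (sym jq′) e))
        ... | inj₂ (inj₂ (jP≡q , _)) with All.lookup q-absent-tail P∈ (≡⇒ofJob P jP≡q)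
        ...   | inj₁ eP≤t₃ = ≤-trans (PartOf.≤end part) eP≤t₃
        ...   | inj₂ t₄≤sP = ⊥-elim (<-irrefl refl (<-≤-trans (≤-<-trans (≤-trans t₄≤sP (PartOf.start≤ part)) (PartOf.nonempty part))
                                                            eq′≤t₄))
        bound P∈ part (after e t₄≤sq′)         jq′ =
          ⊥-elim (a-done-by-t₄ P∈ (trans (sym e) jq′) (PartOf.nonempty part) (PartOf.≤end part) t₄≤sq′)

      compatible′ : AllPairs Compatible S′
      compatible′ = relabelled-compatible ordered (AllPairs.zip (procOK , jobOK))

      feasible′ : Feasible J S′
      feasible′ = list⇒feasible
        (record { nonempty = relabelled-nonempty S ordered
                ; released = inherited (λ w s → r J w ≤ s) (λ s≤s′ r≤s → ≤-trans r≤s s≤s′) released a-released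
                               (≤-trans (subst (λ j → r J j ≤ start Q) job-Q (All.lookup released Q∈)) Q-from)
                ; procOK   = AllPairs.map proj₁ compatible′
                ; jobOK    = AllPairs.map proj₂ compatible′ })
        unit′
        (inherited (λ w s → ∀ d → _≺_ J d w → C J S′ d ≤ s) (λ s≤s′ h d d≺ → ≤-trans (h d d≺) s≤s′)
           (All.map (λ h d d≺ → ≤-trans (C′≤C d) (h d d≺)) precedence)
           (λ d d≺ → ≤-trans (C′≤C d) (a-preds-done d d≺))
           (λ d d≺ → ≤-trans (C′≤C d) (≤-trans (All.lookup precedence Q∈ d (subst (_≺_ J d) (sym job-Q) d≺)) Q-from)))

      impossible : ⊥
      impossible = optimal-unimprovable opt feasible′ C′≤C a (≤-<-trans C′a≤t₃ t₃<t₄)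

    drop : Fin n → Fin n → Maybe (Fin n)
    drop a j = if does (j ≟ᶠ a) then nothing else just j

    drop-just : ∀ {j w} → drop a j ≡ just w → j ≡ w × j ≢ a
    drop-just {j} h with j ≟ᶠ a
    ... | no j≢a = just-injective h , j≢a

    -- a's time in [t₃, t₄] is dropped and a runs on the idle processor i during [t₁, t₂] instead.
    module Move (i : Fin 2) (i-idle : Avoids (onProc i) t₁ t₂ S) where

      open Surgery J t₁≤t₂ t₂≤t₃ t₃≤t₄ just (drop a)
      open Pairwise (λ hi hj → just-injective (trans hi (sym hj)))
                    (λ hi hj → trans (proj₁ (drop-just hi)) (sym (proj₁ (drop-just hj))))

      N : Pc
      N = piece a i t₁ t₂

      S′ : List Pc
      S′ = N ∷ relabelled S

      keeps-job : ∀ {P q′} → Region P q′ → job q′ ≡ job P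
      keeps-job (before e _)          = e
      keeps-job (reassigned₂ l _ _)   = sym (just-injective l)
      keeps-job (between e _ _)       = e
      keeps-job (reassigned₄ l _ _)   = sym (proj₁ (drop-just l))
      keeps-job (after e _)           = e


      into₄-a : ∀ P → into₄ a P ≡ false
      into₄-a P with job P ≟ᶠ a
      ... | yes _   = refl
      ... | no j≢a  = ≢⇒ofJob P j≢a

      into₄-other : ∀ {w} → w ≢ a → ∀ P → into₄ w P ≡ ofJob w P
      into₄-other w≢a P with job P ≟ᶠ a
      ... | no _    = refl
      ... | yes j≡a = sym (≢⇒ofJob P (λ j≡w → w≢a (trans (sym j≡w) j≡a)))

      L₂ L₄ : Fin n → ℚ
      L₂ w = sumIf (ofJob w) I₂ S
      L₄ w = sumIf (ofJob w) I₄ S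

      unit′ : ∀ w → len J S′ w ≡ 1ℚ
      unit′ w with w ≟ᶠ a
      ... | yes refl = begin
        len J S′ a
          ≡⟨ trans (len≡sumIf S′ a) (sumIf-∷-true (ofJob a) duration {N} (relabelled S) (≡⇒ofJob N refl)) ⟩
        duration N + sumIf (ofJob a) duration (relabelled S)
          ≡⟨ cong (duration N +_) (relabelled-duration S a ordered) ⟩
        duration N + ((sumIf (ofJob a) duration S - L₂ a - L₄ a) + (L₂ a + sumIf (into₄ a) I₄ S))
          ≡⟨ cong₂ (λ x y → duration N + ((x - L₂ a - L₄ a) + (L₂ a + y)))
                   (unit a) (sumIf-none (into₄ a) I₄ S (All.universal into₄-a S)) ⟩
        duration N + ((1ℚ - L₂ a - L₄ a) + (L₂ a + 0ℚ))
          ≡⟨ cong₂ (λ x y → duration N + ((1ℚ - x - y) + (x + 0ℚ))) a-absent-early a-fills-tail ⟩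
        (u + δ - u) + ((1ℚ - 0ℚ - δ) + (0ℚ + 0ℚ))
          ≡⟨ solve 2 (λ u δ → (u :+ δ :- u) :+ ((con 1ℚ :- con 0ℚ :- δ) :+ (con 0ℚ :+ con 0ℚ)) := con 1ℚ) refl u δ ⟩
        1ℚ ∎
        where open ≡-Reasoning
      ... | no w≢a = begin
        len J S′ w
          ≡⟨ trans (len≡sumIf S′ w) (sumIf-∷-false (ofJob w) duration {N} (relabelled S) (≢⇒ofJob N (w≢a ∘ sym))) ⟩
        sumIf (ofJob w) duration (relabelled S)
          ≡⟨ relabelled-duration S w ordered ⟩
        (sumIf (ofJob w) duration S - L₂ w - L₄ w) + (L₂ w + sumIf (into₄ w) I₄ S)
          ≡⟨ cong₂ (λ x y → (x - L₂ w - L₄ w) + (L₂ w + y)) (unit w) (sumIf-cong-filter _ _ I₄ S (All.universal (into₄-other w≢a) S)) ⟩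
        (1ℚ - L₂ w - L₄ w) + (L₂ w + L₄ w)
          ≡⟨ solve 2 (λ x y → (con 1ℚ :- x :- y) :+ (x :+ y) := con 1ℚ) refl (L₂ w) (L₄ w) ⟩
        1ℚ ∎
        where open ≡-Reasoning

      parts-within-C : ∀ w → All (λ q′ → job q′ ≡ w → end q′ ≤ C J S w) (relabelled S)
      parts-within-C w = all-relabelled ordered (All.tabulate (λ {P} P∈ {q′} part jq′ →
        ≤-trans (PartOf.≤end part) (end≤C P∈ (trans (sym (keeps-job (PartOf.region part))) jq′))))

      C′≤C : ∀ w → C J S′ w ≤ C J S w
      C′≤C w = C≤⇒ S′ (C-nonneg S w) ((λ a≡w → subst (λ j → t₂ ≤ C J S j) a≡w (≤-trans t₂≤t₃ t₃≤t₄)) ∷ parts-within-C w)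

      C′a≤t₃ : C J S′ a ≤ t₃
      C′a≤t₃ = C≤⇒ S′ 0≤t₃
        ((λ _ → t₂≤t₃) ∷ all-relabelled ordered (All.tabulate (λ {P} P∈ {q′} part → bound P∈ part (PartOf.region part))))
        where
        bound : ∀ {P q′} → P ∈ S → PartOf P q′ → Region P q′ → job q′ ≡ a → end q′ ≤ t₃
        bound P∈ part (before _ eq′≤t₁)        _   = ≤-trans eq′≤t₁ t₁≤t₃
        bound P∈ part (reassigned₂ _ _ eq′≤t₂) _   = ≤-trans eq′≤t₂ t₂≤t₃
        bound P∈ part (between _ _ eq′≤t₃)     _   = eq′≤t₃
        bound P∈ part (reassigned₄ l _ _)      jq′ = ⊥-elim (proj₂ (drop-just l) (trans (proj₁ (drop-just l)) jq′))
        bound P∈ part (after e t₄≤sq′)         jq′ =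
          ⊥-elim (a-done-by-t₄ P∈ (trans (sym e) jq′) (PartOf.nonempty part) (PartOf.≤end part) t₄≤sq′)

      N-compatible : All (Compatible N) (relabelled S)
      N-compatible = all-relabelled ordered (All.tabulate (λ {P} P∈ {q′} part →
        (λ i≡ → clear (All.lookup i-idle P∈ (≡⇒onProc P (trans (sym (PartOf.proc≡ part)) (sym i≡)))) part) ,
        (λ a≡ → clear (All.lookup a-absent P∈ (≡⇒ofJob P (trans (sym (keeps-job (PartOf.region part))) (sym a≡)))) part)))
        where
        clear : ∀ {P q′} → end P ≤ t₁ ⊎ t₂ ≤ start P → PartOf P q′ → Disjoint J N q′
        clear (inj₁ eP≤t₁) part = inj₂ (≤-trans (PartOf.≤end part) eP≤t₁)
        clear (inj₂ t₂≤sP) part = inj₁ (≤-trans t₂≤sP (PartOf.start≤ part))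

      compatible′ : AllPairs Compatible (relabelled S)
      compatible′ = relabelled-compatible ordered (AllPairs.zip (procOK , jobOK))

      feasible′ : Feasible J S′
      feasible′ = list⇒feasible
        (record { nonempty = t₁<t₂ ∷ relabelled-nonempty S ordered
                ; released = a-released ∷ all-relabelled ordered (All.map (λ {P} rP {q′} part →
                               subst (λ j → r J j ≤ start q′) (sym (keeps-job (PartOf.region part)))
                                     (≤-trans rP (PartOf.start≤ part))) released)
                ; procOK   = All.map proj₁ N-compatible ∷ AllPairs.map proj₁ compatible′
                ; jobOK    = All.map proj₂ N-compatible ∷ AllPairs.map proj₂ compatible′ })
        unit′
        ((λ d d≺ → ≤-trans (C′≤C d) (a-preds-done d d≺)) ∷
         all-relabelled ordered (All.map (λ {P} hP {q′} part d d≺ →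
           ≤-trans (C′≤C d) (≤-trans (hP d (subst (_≺_ J d) (keeps-job (PartOf.region part)) d≺)) (PartOf.start≤ part))) precedence))

      impossible : ⊥
      impossible = optimal-unimprovable opt feasible′ C′≤C a (≤-<-trans C′a≤t₃ t₃<t₄)

module FiniteChoice where

  open import Data.Nat as ℕ using (ℕ; z≤n; s≤s)
  open import Data.Rational using (_≤_)
  open import Data.Rational.Properties using (≤-refl; ≤-trans; ≤-total)
  open import Data.List.Membership.Propositional.Properties using (∈-allFin; ∈-filter⁺; ∈-filter⁻)
  open import Data.List.Relation.Unary.Unique.Propositional using (Unique)
  open import Data.List.Relation.Unary.Unique.Propositional.Properties as Unique using (allFin⁺)
  open import Relation.Unary using (Decidable)

  argmin : ∀ {A : Set} (g : A → ℚ) {b} xs → b ∈ xs → ∃ λ m → m ∈ xs × All (λ w → g m ≤ g w) xs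
  argmin g (x ∷ [])      _ = x , here refl , ≤-refl ∷ []
  argmin g (x ∷ x′ ∷ xs) _ with argmin g (x′ ∷ xs) (here refl)
  ... | m , m∈ , m-min with ≤-total (g x) (g m)
  ...   | inj₁ gx≤gm = x , here refl , ≤-refl ∷ All.map (≤-trans gx≤gm) m-min
  ...   | inj₂ gm≤gx = m , there m∈ , gm≤gx ∷ m-min

  module _ {n} {P : Fin n → Set} (P? : Decidable P) where

    minimum : (g : Fin n → ℚ) → ∀ {b} → P b → ∃ λ a → P a × ∀ w → P w → g a ≤ g w
    minimum g {b} Pb with argmin g (filter P? (allFin n)) (∈-filter⁺ P? (∈-allFin b) Pb)
    ... | a , a∈ , a-min = a , proj₂ (∈-filter⁻ P? {xs = allFin n} a∈) , λ w Pw → All.lookup a-min (∈-filter⁺ P? (∈-allFin w) Pw)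

    NoThree : Set
    NoThree = ∀ {b₁ b₂ b₃} → P b₁ → P b₂ → P b₃ → b₁ ≢ b₂ → b₁ ≢ b₃ → b₂ ≢ b₃ → ⊥

    count≤2 : NoThree → length (filter P? (allFin n)) ℕ.≤ 2
    count≤2 no-three = bound (filter P? (allFin n)) (Unique.filter⁺ P? (allFin⁺ n)) (λ b∈ → proj₂ (∈-filter⁻ P? {xs = allFin n} b∈))
      where
      bound : ∀ xs → Unique xs → (∀ {b} → b ∈ xs → P b) → length xs ℕ.≤ 2
      bound []                    _ _ = z≤n
      bound (_ ∷ [])              _ _ = s≤s z≤n
      bound (_ ∷ _ ∷ [])          _ _ = s≤s (s≤s z≤n)
      bound (b₁ ∷ b₂ ∷ b₃ ∷ _) ((b₁≢b₂ ∷ b₁≢b₃ ∷ _) ∷ (b₂≢b₃ ∷ _) ∷ _) all-P =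
        ⊥-elim (no-three (all-P (here refl)) (all-P (there (here refl))) (all-P (there (there (here refl)))) b₁≢b₂ b₁≢b₃ b₂≢b₃)

module Argument (J : Instance) {S : List (Piece J)} (opt : Optimal J S) (x y : ℚ)
                (late  : ∀ a → InB J S x y a → y Data.Rational.≤ C J S a)
                (early : ∀ a → InB J S x y a → r J a Data.Rational.≤ x) where

  open import Data.Rational hiding (_≟_)
  open import Data.Rational.Properties hiding (_≟_)
  open Instance J
  open Interval
  open FilteredSum
  open Schedules J
  open Exchange J
  open FeasibleFacts (proj₁ opt)

  lenI : Fin n → ℚ
  lenI w = sumIf (ofJob w) (timeIn x y) S

  B⇒0<lenI : ∀ {w} → InB J S x y w → 0ℚ < lenI w
  B⇒0<lenI {w} w∈B = subst (0ℚ <_) (lenIn≡sumIf S x y w) (proj₁ w∈B)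

  B⇒lenI<width : ∀ {w} → InB J S x y w → lenI w < y - x
  B⇒lenI<width {w} w∈B = subst (_< y - x) (lenIn≡sumIf S x y w) (proj₂ w∈B)

  lenI⇒B : ∀ {w} → 0ℚ < lenI w → lenI w < y - x → InB J S x y w
  lenI⇒B {w} pos lt = subst (0ℚ <_) (sym (lenIn≡sumIf S x y w)) pos , subst (_< y - x) (sym (lenIn≡sumIf S x y w)) lt

  0≤x : ∀ {w} → InB J S x y w → 0ℚ ≤ x
  0≤x {w} w∈B = ≤-trans (r-nonneg w) (early w w∈B)

  start<hi : ∀ P u v → 0ℚ < timeIn u v P → start P < v
  start<hi P u v pos = ≤-<-trans (p≤p⊔q (start P) u) (<-≤-trans (overlapLen-pos⇒ (start P) (end P) u v pos) (p⊓q≤q (end P) v))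

  -- A predecessor d completing inside (x, y) would itself run for a positive time less than y - x
  -- in [x, y], i.e. lie in B, although it completes before y.
  B-preds-done : ∀ {w} → InB J S x y w → ∀ d → _≺_ J d w → C J S d ≤ x
  B-preds-done {w} w∈B d d≺w with C J S d ≤? x | positive-piece S w x y (B⇒0<lenI w∈B)
  ... | yes Cd≤x | _ = Cd≤x
  ... | no  Cd≰x | Q , Q∈ , jQ , posQ = ⊥-elim (<-irrefl refl (<-≤-trans Cd<y (late d d∈B)))
    where
    x<Cd : x < C J S d
    x<Cd = ≰⇒> Cd≰x
    Cd<y : C J S d < y
    Cd<y = ≤-<-trans (All.lookup precedence Q∈ d (subst (_≺_ J d) (sym jQ) d≺w)) (start<hi Q x y posQ)
    open LastPiece (last-piece S d (≤-<-trans (0≤x w∈B) x<Cd))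
    sD<eD : start last < end last
    sD<eD = All.lookup nonempty last∈
    x<eD : x < end last
    x<eD = subst (x <_) (sym end-last) x<Cd
    eD<y : end last < y
    eD<y = subst (_< y) (sym end-last) Cd<y
    lenI-d-pos : 0ℚ < lenI d
    lenI-d-pos = <-≤-trans (overlapLen-pos⇐ sD<eD (<-trans sD<eD eD<y) x<eD (<-trans x<eD eD<y)) (timeIn≤lenIn x y last∈ job-last)
    lenI-d<width : lenI d < y - x
    lenI-d<width = begin-strict
      lenI d
        ≡⟨ sumIf-timeIn-split (ofJob d) S x (C J S d) y ordered (<⇒≤ x<Cd) (<⇒≤ Cd<y) ⟩
      sumIf (ofJob d) (timeIn x (C J S d)) S + sumIf (ofJob d) (timeIn (C J S d) y) S
        ≡⟨ cong (sumIf (ofJob d) (timeIn x (C J S d)) S +_)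
                (absent⇒lenIn≡0 d (C J S d) y (All.tabulate (λ {P} P∈ o → inj₁ (end≤C P∈ (ofJob⇒≡ P o))))) ⟩
      sumIf (ofJob d) (timeIn x (C J S d)) S + 0ℚ
        ≡⟨ +-identityʳ _ ⟩
      sumIf (ofJob d) (timeIn x (C J S d)) S
        ≤⟨ job-fits d x (C J S d) (<⇒≤ x<Cd) ⟩
      C J S d - x
        <⟨ +-monoˡ-< (- x) Cd<y ⟩
      y - x ∎
      where open ≤-Reasoning hiding (start)
    d∈B : InB J S x y d
    d∈B = lenI⇒B lenI-d-pos lenI-d<width

  private
    AllPairs-∈ : ∀ {R : Pc → Pc → Set} → (∀ {p q} → R p q → R q p) → ∀ {L} → AllPairs R L →
                 ∀ {p q} → p ∈ L → q ∈ L → p ≡ q ⊎ R p q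
    AllPairs-∈ sym-R (Rp ∷ _)   (here refl) (here refl) = inj₁ refl
    AllPairs-∈ sym-R (Rp ∷ _)   (here refl) (there q∈)  = inj₂ (All.lookup Rp q∈)
    AllPairs-∈ sym-R (Rp ∷ _)   (there p∈)  (here refl) = inj₂ (sym-R (All.lookup Rp p∈))
    AllPairs-∈ sym-R (_  ∷ Rps) (there p∈)  (there q∈)  = AllPairs-∈ sym-R Rps p∈ q∈

    does⇒ : ∀ {A : Set} (d : Dec A) → does d ≡ true → A
    does⇒ (yes a) _ = a

    two-of-three-equal : ∀ (i j k : Fin 2) → i ≡ j ⊎ i ≡ k ⊎ j ≡ k
    two-of-three-equal zero       zero       _          = inj₁ refl
    two-of-three-equal zero       (suc zero) zero       = inj₂ (inj₁ refl)
    two-of-three-equal zero       (suc zero) (suc zero) = inj₂ (inj₂ refl)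
    two-of-three-equal (suc zero) zero       zero       = inj₂ (inj₂ refl)
    two-of-three-equal (suc zero) zero       (suc zero) = inj₂ (inj₁ refl)
    two-of-three-equal (suc zero) (suc zero) _          = inj₁ refl

  module Minimal {a} (a∈B : InB J S x y a) (a-min : ∀ w → InB J S x y w → C J S a ≤ C J S w) where

    Ca : ℚ
    Ca = C J S a

    x<y : x < y
    x<y = 0<q-p⇒p<q (<-trans (B⇒0<lenI a∈B) (B⇒lenI<width a∈B))

    y≤Ca : y ≤ Ca
    y≤Ca = late a a∈B

    last-of-a : LastPiece S a
    last-of-a = last-piece S a (≤-<-trans (0≤x a∈B) (<-≤-trans x<y y≤Ca))

    open LastPiece last-of-a public

    start-last<Ca : start last < Ca
    start-last<Ca = subst (start last <_) end-last (All.lookup nonempty last∈)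

    Straddles : Pc → Set
    Straddles P = start P < Ca × Ca ≤ end P

    Running : Fin n → Set
    Running w = Any (λ P → job P ≡ w × Straddles P) S

    running? : ∀ w → Dec (Running w)
    running? w = Any.any? (λ P → (job P ≟ᶠ w) ×-dec ((start P <? Ca) ×-dec (Ca ≤? end P))) S

    straddlers-on-different-procs : ∀ {P Q} → P ∈ S → Q ∈ S → job P ≢ job Q → Straddles P → Straddles Q → proc P ≢ proc Q
    straddlers-on-different-procs P∈ Q∈ jP≢jQ (sP<Ca , Ca≤eP) (sQ<Ca , Ca≤eQ) same-proc
      with AllPairs-∈ (λ {p} {q} h e → Disjoint-sym {p} {q} (h (sym e))) procOK P∈ Q∈
    ... | inj₁ P≡Q = jP≢jQ (cong job P≡Q)
    ... | inj₂ disj with disj same-proc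
    ...   | inj₁ eP≤sQ = <-irrefl refl (<-≤-trans sQ<Ca (≤-trans Ca≤eP eP≤sQ))
    ...   | inj₂ eQ≤sP = <-irrefl refl (<-≤-trans sP<Ca (≤-trans Ca≤eQ eQ≤sP))

    -- Pigeonhole: the straddling pieces of w₁, w₂ and the last piece of a would need three processors.
    running-unique : ∀ {w₁ w₂} → Running w₁ → Running w₂ → w₁ ≢ a → w₂ ≢ a → w₁ ≡ w₂
    running-unique {w₁} {w₂} r₁ r₂ w₁≢a w₂≢a with w₁ ≟ᶠ w₂ | find r₁ | find r₂
    ... | yes w₁≡w₂ | _ | _ = w₁≡w₂
    ... | no w₁≢w₂ | P₁ , P₁∈ , refl , st₁ | P₂ , P₂∈ , refl , st₂ =
      ⊥-elim (Sum.[ apart₁₂ , Sum.[ apart₁ , apart₂ ] ] (two-of-three-equal (proc P₁) (proc P₂) (proc last)))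
      where
      apart₁₂ = straddlers-on-different-procs P₁∈ P₂∈ w₁≢w₂ st₁ st₂
      last-straddles : Straddles last
      last-straddles = start-last<Ca , ≤-reflexive (sym end-last)
      apart₁ = straddlers-on-different-procs P₁∈ last∈ (λ e → w₁≢a (trans e job-last)) st₁ last-straddles
      apart₂ = straddlers-on-different-procs P₂∈ last∈ (λ e → w₂≢a (trans e job-last)) st₂ last-straddles

    absent⇒before-last : ∀ {w₁ w₂} → w₁ < w₂ → w₂ ≤ y → Avoids (ofJob a) w₁ w₂ S → w₂ ≤ start last
    absent⇒before-last {w₁} {w₂} w₁<w₂ w₂≤y a-absent =
      Sum.[ impossible , (λ w₂≤s → w₂≤s) ] (All.lookup a-absent last∈ (≡⇒ofJob last job-last))
      where
      impossible : end last ≤ w₁ → w₂ ≤ start last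
      impossible end≤w₁ =
        ⊥-elim (<-irrefl refl (<-≤-trans w₁<w₂ (≤-trans w₂≤y (≤-trans y≤Ca (≤-trans (≤-reflexive (sym end-last)) end≤w₁)))))

    slot : ∀ {w₁ w₂ δ} → x ≤ w₁ → w₂ ≤ y → 0ℚ < δ → w₁ + δ ≤ w₂ → start last ≤ Ca - δ →
           Avoids (ofJob a) w₁ w₂ S → EarlierSlot S a
    slot {w₁} {w₂} {δ} x≤w₁ w₂≤y 0<δ w₁+δ≤w₂ last-covers a-absent = record
      { last-of-a        = last-of-a
      ; u                = w₁
      ; δ                = δ
      ; 0<δ              = 0<δ
      ; slot<tail        = ≤-trans w₁+δ≤w₂ (≤-trans (absent⇒before-last w₁<w₂ w₂≤y a-absent) last-covers)
      ; last-covers-tail = last-covers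
      ; a-absent         = avoids-shrink ≤-refl w₁+δ≤w₂ a-absent
      ; a-preds-done     = λ d d≺a → ≤-trans (B-preds-done a∈B d d≺a) x≤w₁
      ; a-released       = ≤-trans (early a a∈B) x≤w₁
      }
      where
      w₁<w₂ : w₁ < w₂
      w₁<w₂ = <-≤-trans (p<p+q w₁ 0<δ) w₁+δ≤w₂

    swap-into : ∀ {Q} → Q ∈ S → job Q ≢ a → ¬ Running (job Q) → Ca ≤ C J S (job Q) →
                ∀ {w₁ w₂} → start Q ≤ w₁ → w₁ < w₂ → w₂ ≤ end Q → x ≤ w₁ → w₂ ≤ y → Avoids (ofJob a) w₁ w₂ S → ⊥
    swap-into {Q} Q∈ q≢a q-not-running Ca≤Cq {w₁} {w₂} sQ≤w₁ w₁<w₂ w₂≤eQ x≤w₁ w₂≤y a-absent =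
      WithSlot.Swap.impossible opt (slot x≤w₁ w₂≤y 0<δ w₁+δ≤w₂ last-covers a-absent)
        (q≢a ∘ sym) Q∈ refl sQ≤w₁ (≤-trans w₁+δ≤w₂ w₂≤eQ) q-absent-tail Ca≤Cq
      where
      q : Fin n
      q = job Q
      ends-early? : ∀ P → Dec (job P ≡ q × end P < Ca)
      ends-early? P = (job P ≟ᶠ q) ×-dec (end P <? Ca)
      early-end : ℚ
      early-end = maxIf (does ∘ ends-early?) end S
      early-end<Ca : early-end < Ca
      early-end<Ca = maxIf-< (does ∘ ends-early?) end S (≤-<-trans (0≤x a∈B) (<-≤-trans x<y y≤Ca))
        (All.universal (λ P → proj₂ ∘ does⇒ (ends-early? P)) S)
      δ : ℚ
      δ = (w₂ - w₁) ⊓ ((Ca - start last) ⊓ (Ca - early-end))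
      0<δ : 0ℚ < δ
      0<δ = ⊓-pos (p<q⇒0<q-p w₁<w₂) (⊓-pos (p<q⇒0<q-p start-last<Ca) (p<q⇒0<q-p early-end<Ca))
      w₁+δ≤w₂ : w₁ + δ ≤ w₂
      w₁+δ≤w₂ = δ≤q-p⇒p+δ≤q (p⊓q≤p (w₂ - w₁) _)
      last-covers : start last ≤ Ca - δ
      last-covers = δ≤q-p⇒p≤q-δ {q = Ca} (≤-trans (p⊓q≤q (w₂ - w₁) _) (p⊓q≤p _ _))
      early-end≤ : early-end ≤ Ca - δ
      early-end≤ = δ≤q-p⇒p≤q-δ {q = Ca} (≤-trans (p⊓q≤q (w₂ - w₁) _) (p⊓q≤q (Ca - start last) _))
      q-absent-tail : Avoids (ofJob q) (Ca - δ) Ca S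
      q-absent-tail = All.tabulate (λ {P} P∈ o → q-piece P∈ (ofJob⇒≡ P o) (Ca ≤? start P) (Ca ≤? end P))
        where
        q-piece : ∀ {P} → P ∈ S → job P ≡ q → Dec (Ca ≤ start P) → Dec (Ca ≤ end P) → end P ≤ Ca - δ ⊎ Ca ≤ start P
        q-piece P∈ jP (yes Ca≤sP) _          = inj₂ Ca≤sP
        q-piece P∈ jP (no Ca≰sP)  (yes Ca≤eP) = ⊥-elim (q-not-running (lose P∈ (jP , ≰⇒> Ca≰sP , Ca≤eP)))
        q-piece {P} P∈ jP (no _)  (no Ca≰eP)  =
          inj₁ (≤-trans (term≤maxIf (does ∘ ends-early?) end S P∈ (dec-true (ends-early? P) (jP , ≰⇒> Ca≰eP))) early-end≤)

    move-into : ∀ i {w₁ w₂} → w₁ < w₂ → x ≤ w₁ → w₂ ≤ y → Avoids (ofJob a) w₁ w₂ S → Avoids (onProc i) w₁ w₂ S → ⊥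
    move-into i {w₁} {w₂} w₁<w₂ x≤w₁ w₂≤y a-absent i-idle =
      WithSlot.Move.impossible opt (slot x≤w₁ w₂≤y 0<δ w₁+δ≤w₂ last-covers a-absent) i (avoids-shrink ≤-refl w₁+δ≤w₂ i-idle)
      where
      δ : ℚ
      δ = (w₂ - w₁) ⊓ (Ca - start last)
      0<δ : 0ℚ < δ
      0<δ = ⊓-pos (p<q⇒0<q-p w₁<w₂) (p<q⇒0<q-p start-last<Ca)
      w₁+δ≤w₂ : w₁ + δ ≤ w₂
      w₁+δ≤w₂ = δ≤q-p⇒p+δ≤q (p⊓q≤p (w₂ - w₁) _)
      last-covers : start last ≤ Ca - δ
      last-covers = δ≤q-p⇒p≤q-δ {q = Ca} (p⊓q≤q (w₂ - w₁) _)

    a-gap : FreeWindow (ofJob a) S x y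
    a-gap = free-window (ofJob a) S ordered x y (B⇒lenI<width a∈B)

    open FreeWindow a-gap renaming (lo to v₁; hi to v₂; u≤lo to x≤v₁; lo<hi to v₁<v₂; hi≤v to v₂≤y; avoids to a-absent-in-gap)

    in-gap⇒not-a : ∀ {P} → P ∈ S → 0ℚ < timeIn v₁ v₂ P → job P ≢ a
    in-gap⇒not-a {P} P∈ pos jP≡a =
      <-irrefl (sym (overlapLen-disjoint (start P) (end P) v₁ v₂ (All.lookup a-absent-in-gap P∈ (≡⇒ofJob P jP≡a)))) pos

    -- Every job running in the gap is running at time Ca (in-gap⇒running), so by running-unique
    -- a single job would have to keep both processors busy.
    busy-gap-impossible : ∀ {b} → InB J S x y b → b ≢ a → ∀ {j₁ j₂} → x ≤ j₁ → j₁ < j₂ → j₂ ≤ y →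
                          j₂ - j₁ ≤ sumIf (ofJob a) (timeIn j₁ j₂) S → j₂ - j₁ ≤ sumIf (ofJob b) (timeIn j₁ j₂) S →
                          (∀ i → v₂ - v₁ ≤ sumIf (onProc i) (timeIn v₁ v₂) S) → ⊥
    busy-gap-impossible {b} b∈B b≢a {j₁} {j₂} x≤j₁ j₁<j₂ j₂≤y a-fills b-fills busy =
      <-irrefl refl (<-≤-trans (p<p+q (v₂ - v₁) 0<width) (≤-trans both-busy (≤-trans all≤e (job-fits e v₁ v₂ (<⇒≤ v₁<v₂)))))
      where
      0<width : 0ℚ < v₂ - v₁
      0<width = p<q⇒0<q-p v₁<v₂
      total : ℚ
      total = sumAll (timeIn v₁ v₂) S
      both-busy : (v₂ - v₁) + (v₂ - v₁) ≤ total
      both-busy = ≤-trans (+-mono-≤ (busy zero) (busy (suc zero))) (≤-reflexive (sumAll≡procs (timeIn v₁ v₂) S))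
      three-fill : ∀ {f} → f ≢ a → f ≢ b → j₂ - j₁ ≤ sumIf (ofJob f) (timeIn j₁ j₂) S → ⊥
      three-fill f≢a f≢b f-fills = <-irrefl refl (<-≤-trans (p<p+q ((j₂ - j₁) + (j₂ - j₁)) (p<q⇒0<q-p j₁<j₂))
        (≤-trans (+-mono-≤ (+-mono-≤ a-fills b-fills) f-fills)
                 (three-jobs-fit (b≢a ∘ sym) (f≢a ∘ sym) (f≢b ∘ sym) j₁ j₂ (<⇒≤ j₁<j₂))))
      early-finisher : ∀ {P} → P ∈ S → 0ℚ < timeIn v₁ v₂ P → C J S (job P) < Ca → ⊥
      early-finisher {P} P∈ pos Cf<Ca =
        three-fill (in-gap⇒not-a P∈ pos) (λ f≡b → <-irrefl refl (<-≤-trans Cf<Ca (subst (λ j → Ca ≤ C J S j) (sym f≡b) (a-min b b∈B))))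
        (filled-on-subwindow (job P) x≤j₁ (<⇒≤ j₁<j₂) j₂≤y f-fills-[x,y])
        where
        f-fills-[x,y] : y - x ≤ lenI (job P)
        f-fills-[x,y] with lenI (job P) <? y - x
        ... | no ≮ = ≮⇒≥ ≮
        ... | yes lt = ⊥-elim (<-irrefl refl (<-≤-trans Cf<Ca (a-min (job P) (lenI⇒B pos-lenI lt))))
          where
          pos-lenI : 0ℚ < lenI (job P)
          pos-lenI = <-≤-trans pos (≤-trans (overlapLen-mono (start P) (end P) x v₁ v₂ y (All.lookup ordered P∈) x≤v₁ (<⇒≤ v₁<v₂) v₂≤y)
                                            (timeIn≤lenIn x y P∈ refl))
      in-gap⇒running : ∀ {P} → P ∈ S → 0ℚ < timeIn v₁ v₂ P → Running (job P)
      in-gap⇒running {P} P∈ pos with running? (job P) | C J S (job P) <? Ca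
      ... | yes run | _        = run
      ... | no idle | yes Cf<Ca = ⊥-elim (early-finisher P∈ pos Cf<Ca)
      ... | no idle | no Cf≮Ca  = ⊥-elim (swap-into P∈ (in-gap⇒not-a P∈ pos) idle (≮⇒≥ Cf≮Ca)
          (p≤p⊔q (start P) v₁) (overlapLen-pos⇒ (start P) (end P) v₁ v₂ pos) (p⊓q≤p (end P) v₂)
          (≤-trans x≤v₁ (p≤q⊔p (start P) v₁)) (≤-trans (p⊓q≤q (end P) v₂) v₂≤y)
          (avoids-shrink (p≤q⊔p (start P) v₁) (p⊓q≤q (end P) v₂) a-absent-in-gap))
      some-piece : ∃ λ P → P ∈ S × (true ≡ true × 0ℚ < timeIn v₁ v₂ P)
      some-piece = find (sumIf-pos (λ _ → true) (timeIn v₁ v₂) S (<-≤-trans (<-trans 0<width (p<p+q (v₂ - v₁) 0<width)) both-busy))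
      e : Fin n
      e = job (proj₁ some-piece)
      all≤e : total ≤ sumIf (ofJob e) (timeIn v₁ v₂) S
      all≤e = sumIf-filter-≤ (λ _ → true) (ofJob e) (timeIn v₁ v₂) S (timeIn-nonneg v₁ v₂ S)
        (All.tabulate (λ {P} P∈ _ not-e → ≮⇒≥ (λ pos → not-e-contra P∈ pos not-e)))
        where
        Q∈ = proj₁ (proj₂ some-piece)
        posQ = proj₂ (proj₂ (proj₂ some-piece))
        not-e-contra : ∀ {P} → P ∈ S → 0ℚ < timeIn v₁ v₂ P → ofJob e P ≡ false → ⊥
        not-e-contra {P} P∈ pos not-e = false≢true (trans (sym not-e) (≡⇒ofJob P
          (running-unique (in-gap⇒running P∈ pos) (in-gap⇒running Q∈ posQ) (in-gap⇒not-a P∈ pos) (in-gap⇒not-a Q∈ posQ))))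

    others-running : ∀ {b} → InB J S x y b → b ≢ a → Running b
    others-running {b} b∈B b≢a with running? b | positive-piece S b x y (B⇒0<lenI b∈B)
    ... | yes run  | _ = run
    ... | no  idle | Bi , Bi∈ , refl , posBi = ⊥-elim (a-fills-or-not (sumIf (ofJob a) (timeIn j₁ j₂) S <? j₂ - j₁))
      where
      j₁ j₂ : ℚ
      j₁ = start Bi ⊔ x
      j₂ = end Bi ⊓ y
      j₁<j₂ : j₁ < j₂
      j₁<j₂ = overlapLen-pos⇒ (start Bi) (end Bi) x y posBi
      x≤j₁ : x ≤ j₁
      x≤j₁ = p≤q⊔p (start Bi) x
      j₂≤y : j₂ ≤ y
      j₂≤y = p⊓q≤q (end Bi) y
      b-fills : j₂ - j₁ ≤ sumIf (ofJob b) (timeIn j₁ j₂) S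
      b-fills = ≤-trans
        (≤-reflexive (sym (overlapLen-full (start Bi) (end Bi) j₁ j₂ (p≤p⊔q (start Bi) x) (<⇒≤ j₁<j₂) (p⊓q≤p (end Bi) y))))
                        (timeIn≤lenIn j₁ j₂ Bi∈ refl)
      processor-idle-or-not : ∀ i → Dec (sumIf (onProc i) (timeIn v₁ v₂) S < v₂ - v₁) → v₂ - v₁ ≤ sumIf (onProc i) (timeIn v₁ v₂) S
      processor-idle-or-not i (no ≮)   = ≮⇒≥ ≮
      processor-idle-or-not i (yes lt) = ⊥-elim (move-into i lo<hi (≤-trans x≤v₁ u≤lo) (≤-trans hi≤v v₂≤y)
                                                   (avoids-shrink u≤lo hi≤v a-absent-in-gap) avoids)
        where open FreeWindow (free-window (onProc i) S ordered v₁ v₂ lt)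
      a-fills-or-not : Dec (sumIf (ofJob a) (timeIn j₁ j₂) S < j₂ - j₁) → ⊥
      a-fills-or-not (yes lt) = swap-into Bi∈ b≢a idle (a-min b b∈B) (≤-trans (p≤p⊔q (start Bi) x) u≤lo) lo<hi
                                  (≤-trans hi≤v (p⊓q≤p (end Bi) y)) (≤-trans x≤j₁ u≤lo) (≤-trans hi≤v j₂≤y) avoids
        where open FreeWindow (free-window (ofJob a) S ordered j₁ j₂ lt)
      a-fills-or-not (no ≮) = busy-gap-impossible b∈B b≢a x≤j₁ j₁<j₂ j₂≤y (≮⇒≥ ≮) b-fills
                                (λ i → processor-idle-or-not i (sumIf (onProc i) (timeIn v₁ v₂) S <? v₂ - v₁))

    two-others-impossible : ∀ {b c} → InB J S x y b → InB J S x y c → b ≢ a → c ≢ a → b ≢ c → ⊥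
    two-others-impossible b∈B c∈B b≢a c≢a b≢c = b≢c (running-unique (others-running b∈B b≢a) (others-running c∈B c≢a) b≢a c≢a)

  no-three-in-B : FiniteChoice.NoThree (inB? J S x y)
  no-three-in-B {b₁} {b₂} {b₃} B₁ B₂ B₃ b₁≢b₂ b₁≢b₃ b₂≢b₃ with FiniteChoice.minimum (inB? J S x y) (C J S) B₁
  ... | a , a∈B , a-min with a ≟ᶠ b₁ | a ≟ᶠ b₂
  ...   | yes refl | _        = Minimal.two-others-impossible a∈B a-min B₂ B₃ (b₁≢b₂ ∘ sym) (b₁≢b₃ ∘ sym) b₂≢b₃
  ...   | no a≢b₁  | yes refl = Minimal.two-others-impossible a∈B a-min B₁ B₃ (a≢b₁ ∘ sym) (b₂≢b₃ ∘ sym) b₁≢b₃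
  ...   | no a≢b₁  | no a≢b₂  = Minimal.two-others-impossible a∈B a-min B₁ B₂ (a≢b₁ ∘ sym) (a≢b₂ ∘ sym) b₁≢b₂

open import Data.Nat using (_≤_)
open import Data.Rational using () renaming (_≤_ to _≤ℚ_)

lemma7 : (J : Instance) (S : Schedule J) → Optimal J S
    → (x y : ℚ) → x ≤ℚ y
    → (∀ a b → InB J S x y a → InB J S x y b → a ≢ b → Independent J a b)
    → (∀ a → InB J S x y a → y ≤ℚ C J S a)
    → (∀ a → InB J S x y a → r J a ≤ℚ x)
    → cardB J S x y ≤ 2
lemma7 J S opt x y _ _ late early = FiniteChoice.count≤2 (inB? J S x y) (Argument.no-three-in-B J opt x y late early)
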